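{- Let $P(x,y)$ be a symmetric polynomial with integer coefficients and let $\mathbf{e}=(e_0,\dots,e_k)$ be a vector of nonnegative integers. Define $\Psi^{\mathbf{e}}(x)=\prod_{i=0}^k\Psi_i(x)^{e_i}$ and $$Q_{\mathsf{Z}}(x,y)=P(2x,2y),\qquad Q_{\mathsf{O}}(x,y)=\Psi^{\mathbf{e}}(x)\Psi^{\mathbf{e}}(y)P(2x+1,2y+1),$$ $$Q_{\mathsf{M}}(x,y)=\tfrac12\big(\Psi^{\mathbf{e}}(x)P(2x+1,2y)+\Psi^{\mathbf{e}}(y)P(2x,2y+1)\big).$$ Then for each $I\in\{\mathsf{Z},\mathsf{O},\mathsf{M}\}$, $Q_I$ is a symmetric polynomial with integer coefficients. Moreover, for every word $T$ over $\{\mathsf{Z},\mathsf{O},\mathsf{M}\}$, writing $TI$ for $T$ followed by the letter $I$ and $\operatorname{shift}\mathbf{e}=(0,e_0,e_1,\dots,e_k)$, we have $\mathfrak{S}^{\mathbf{e}}_{TI}(P)=\mathfrak{S}^{\operatorname{shift}\mathbf{e}}_T(Q_I)$ for $I\in\{\mathsf{Z},\mathsf{O}\}$, and $\mathfrak{S}^{\mathbf{e}}_{T\mathsf{M}}(P)=2\,\mathfrak{S}^{\operatorname{shift}\mathbf{e}}_T(Q_{\mathsf{M}})$.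
   Context: $\Theta_2(z)$ is the odd part of a positive integer $z$ and $\nu_2(z)$ its $2$-adic valuation. For $i\ge 0$, $\Psi_i(x)=\prod_{j=1}^{2^i}\big(2^{i+1-\nu_2(j)}x+\Theta_2(j)\big)$, an integer polynomial. For a word $T$ of length $L$ over the alphabet $\{\mathsf{Z},\mathsf{O},\mathsf{M}\}$, the pairs "of type $T$" are the ordered pairs $(x,y)$ of integers with $0\le x,y<2^L$ such that, writing $x$ and $y$ in binary with exactly $L$ digits (padding with leading zeroes) as the two rows of a $2\times L$ matrix, the $j$-th column (from the left) contains two $0$s if the $j$-th letter of $T$ is $\mathsf{Z}$, two $1$s if it is $\mathsf{O}$, and one $0$ and one $1$ if it is $\mathsf{M}$. (For the empty word the only pair is $(0,0)$.) For a vector $\mathbf{f}=(f_0,\dots,f_m)$ of integers and a polynomial $R$, set $\mathfrak{S}^{\mathbf{f}}_T(R)=\sum R(x,y)\prod_{i=0}^m\big(\Theta_2((2^ix)!)\,\Theta_2((2^iy)!)\big)^{f_i}$, the sum over all pairs $(x,y)$ of type $T$. -}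

module Defs where

open import Data.Nat as ℕ using (ℕ; zero; suc; _∸_; _≡ᵇ_)
open import Data.Nat.DivMod using (_/_; _%_)
open import Data.Nat using (_!)
open import Data.Integer as ℤ using (ℤ; +_)
open import Data.Fin using (Fin; toℕ) renaming (zero to fz; suc to fs)
open import Data.Bool using (Bool; true; false; _∧_; _∨_; if_then_else_)
open import Data.List as List using (List; []; _∷_; length; map; foldr; filter; concatMap; upTo)
open import Data.Vec using (Vec; []; _∷_)
open import Data.Product using (_×_; _,_; proj₁; proj₂)
open import Data.Bool using (T?)
open import Relation.Binary.PropositionalEquality using (_≡_)

-- 2-adic valuation and odd part (by bounded recursion; the fuel n is
-- always sufficient for a positive argument n)

ν₂aux : ℕ → ℕ → ℕ
ν₂aux zero    n = zero
ν₂aux (suc f) zero = zero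
ν₂aux (suc f) (suc n) =
  if (suc n % 2) ≡ᵇ 0 then suc (ν₂aux f (suc n / 2)) else zero

-- ν₂ z : 2-adic valuation of z (meaningful for z ≥ 1)
ν₂ : ℕ → ℕ
ν₂ n = ν₂aux n n

Θ₂aux : ℕ → ℕ → ℕ
Θ₂aux zero    n = n
Θ₂aux (suc f) zero = zero
Θ₂aux (suc f) (suc n) =
  if (suc n % 2) ≡ᵇ 0 then Θ₂aux f (suc n / 2) else suc n

-- Θ₂ z : odd part of z (meaningful for z ≥ 1)
Θ₂ : ℕ → ℕ
Θ₂ n = Θ₂aux n n

prodℤ : List ℤ → ℤ
prodℤ = foldr ℤ._*_ (+ 1)

sumℤ : List ℤ → ℤ
sumℤ = foldr ℤ._+_ (+ 0)

sumFin : ∀ {n} → (Fin n → ℤ) → ℤ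
sumFin {zero}  f = + 0
sumFin {suc n} f = f fz ℤ.+ sumFin (λ i → f (fs i))

-- Bivariate polynomials with integer coefficients:
-- coefficient c i j of x^i y^j for i, j < n.

record Poly2 : Set where
  constructor poly2
  field
    size  : ℕ
    coeff : Fin size → Fin size → ℤ
open Poly2 public

eval : Poly2 → ℤ → ℤ → ℤ
eval (poly2 n c) x y =
  sumFin (λ i → sumFin (λ j →
    c i j ℤ.* (x ℤ.^ toℕ i) ℤ.* (y ℤ.^ toℕ j)))

SymmetricPoly : Poly2 → Set
SymmetricPoly (poly2 n c) = ∀ i j → c i j ≡ c j i

Ψ : ℕ → ℤ → ℤ
Ψ i x = prodℤ (map (λ j → (+ (2 ℕ.^ (suc i ∸ ν₂ j))) ℤ.* x ℤ.+ + Θ₂ j)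
                   (map suc (upTo (2 ℕ.^ i))))

Ψvec-from : ∀ {m} → ℕ → Vec ℕ m → ℤ → ℤ
Ψvec-from i []       x = + 1
Ψvec-from i (e ∷ es) x = (Ψ i x ℤ.^ e) ℤ.* Ψvec-from (suc i) es x

Ψᵉ : ∀ {m} → Vec ℕ m → ℤ → ℤ
Ψᵉ e = Ψvec-from 0 e

data Letter : Set where
  Z O M : Letter

Word : Set
Word = List Letter

bit : ℕ → ℕ → ℕ
bit x zero    = x % 2
bit x (suc k) = bit (x / 2) k

columnOK : Letter → ℕ → ℕ → Bool
columnOK Z a b = (a ≡ᵇ 0) ∧ (b ≡ᵇ 0)
columnOK O a b = (a ≡ᵇ 1) ∧ (b ≡ᵇ 1)
columnOK M a b = ((a ≡ᵇ 0) ∧ (b ≡ᵇ 1)) ∨ ((a ≡ᵇ 1) ∧ (b ≡ᵇ 0))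

-- the columns of the L-digit binary expansions of x, y match the word,
-- the first letter corresponding to the leftmost column (digit L-1)
matches : Word → ℕ → ℕ → Bool
matches []      x y = true
matches (I ∷ T) x y = columnOK I (bit x (length T)) (bit y (length T)) ∧ matches T x y

pairsOfType : Word → List (ℕ × ℕ)
pairsOfType T =
  filter (λ p → T? (matches T (proj₁ p) (proj₂ p)))
    (concatMap (λ x → map (λ y → (x , y)) (upTo (2 ℕ.^ length T)))
               (upTo (2 ℕ.^ length T)))

-- 𝔖^f_T(R) = Σ_{(x,y) of type T} R(x,y) ∏_i (Θ₂((2^i x)!) Θ₂((2^i y)!))^{f_i}
-- (exponent vectors with nonnegative entries, which is all that is used)

weight-from : ∀ {m} → ℕ → Vec ℕ m → ℕ → ℕ → ℕ
weight-from i []       x y = 1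
weight-from i (f ∷ gs) x y =
  ((Θ₂ ((2 ℕ.^ i ℕ.* x) !) ℕ.* Θ₂ ((2 ℕ.^ i ℕ.* y) !)) ℕ.^ f) ℕ.* weight-from (suc i) gs x y

𝔖 : ∀ {m} → Vec ℕ m → Word → Poly2 → ℤ
𝔖 f T R = sumℤ (map (λ p → let x = proj₁ p ; y = proj₂ p in
                         eval R (+ x) (+ y) ℤ.* + weight-from 0 f x y)
                    (pairsOfType T))

-- Write both coordinates of a pair by their last binary digit: the pairs of type T I are exactly the
-- (a + 2x, b + 2y) with (x, y) of type T and (a, b) a column allowed by I. Since
-- (2^{i+1}x + 2^i)! / (2^{i+1}x)! = ∏_{j=1}^{2^i} (2^{i+1}x + j) and the odd part of 2^{i+1}x + j is
-- 2^{i+1-ν₂(j)}x + Θ₂(j), one has Θ₂((2^i (a + 2x))!) = Θ₂((2^{i+1}x)!) Ψ_i(x)^a, so the weight for e at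
-- (a + 2x, b + 2y) is the weight for shift e at (x, y) times Ψ^e(x)^a Ψ^e(y)^b. Each Q_I is built from the coefficients c_ij of P as Σ c_ij A_i(x) A_j(y), which is symmetric
-- because c is. For M, Ψ^e(x)(2x+1)^i ≡ 1 and (2y)^j ≡ 0^j modulo 2ℤ[x], so the numerator is 2 Σ_i c_i0
-- plus twice a symmetric integer polynomial.

module Submission where

open import Defs

module OddPart where

  open import Data.Nat
  open import Data.Nat.Properties
  open import Data.Nat.DivMod using (_/_; _%_; m≡m%n+[m/n]*n; m%n<n; m/n<m)
  open import Data.Empty using (⊥-elim)
  open import Data.Product using (∃; _×_; _,_; proj₁; proj₂)
  open import Relation.Binary.PropositionalEquality
  open import Relation.Nullary using (yes; no)
  open import Data.Nat.Tactic.RingSolver using (solve-∀)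

  Odd : ℕ → Set
  Odd u = ∃ λ k → u ≡ 1 + 2 * k

  Odd⇒>0 : ∀ {u} → Odd u → 0 < u
  Odd⇒>0 (_ , refl) = z<s

  Odd-* : ∀ {u v} → Odd u → Odd v → Odd (u * v)
  Odd-* (k , refl) (l , refl) = k + l + 2 * k * l , expand k l
    where
    expand : ∀ k l → (1 + 2 * k) * (1 + 2 * l) ≡ 1 + 2 * (k + l + 2 * k * l)
    expand = solve-∀

  2^a*odd-injective : ∀ a b {u v} → 2 ^ a * u ≡ 2 ^ b * v → Odd u → Odd v → u ≡ v
  2^a*odd-injective zero    zero    {u} {v} eq _ _ = *-cancelˡ-≡ u v 1 eq
  2^a*odd-injective zero    (suc b) {u} {v} eq (k , refl) _ =
    ⊥-elim (even≢odd (2 ^ b * v) k (sym (trans (sym (*-identityˡ _)) (trans eq (*-assoc 2 (2 ^ b) v)))))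
  2^a*odd-injective (suc a) zero    {u} {v} eq _ (k , refl) =
    ⊥-elim (even≢odd (2 ^ a * u) k (trans (sym (*-assoc 2 (2 ^ a) u)) (trans eq (*-identityˡ _))))
  2^a*odd-injective (suc a) (suc b) {u} {v} eq =
    2^a*odd-injective a b (*-cancelˡ-≡ (2 ^ a * u) (2 ^ b * v) 2
      (trans (sym (*-assoc 2 (2 ^ a) u)) (trans eq (*-assoc 2 (2 ^ b) v))))

  halves : ∀ n → n ≡ n % 2 + 2 * (n / 2)
  halves n = trans (m≡m%n+[m/n]*n n 2) (cong (n % 2 +_) (*-comm (n / 2) 2))

  -- The fuel f ≥ n of ν₂aux and Θ₂aux is enough: each step halves the argument.
  ν₂aux-Θ₂aux-decomposition : ∀ f n → 0 < n → n ≤ f →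
    n ≡ 2 ^ ν₂aux f n * Θ₂aux f n × Odd (Θ₂aux f n)
  ν₂aux-Θ₂aux-decomposition (suc f) (suc n) _ n≤f
    with suc n % 2 in r | m%n<n (suc n) 2
  ... | 0 | _ = trans n≡2m (trans (cong (2 *_) (proj₁ ih)) (sym (*-assoc 2 (2 ^ ν₂aux f m) (Θ₂aux f m))))
              , proj₂ ih
    where
    m = suc n / 2
    n≡2m : suc n ≡ 2 * m
    n≡2m = trans (halves (suc n)) (cong (_+ 2 * m) r)
    0<m : 0 < m
    0<m with m in m≡0
    ... | zero  = ⊥-elim (1+n≢0 (trans n≡2m (cong (2 *_) m≡0)))
    ... | suc _ = z<s
    ih = ν₂aux-Θ₂aux-decomposition f m 0<m (≤-pred (<-≤-trans (m/n<m (suc n) 2 (s≤s (s≤s z≤n))) n≤f))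
  ... | 1 | _ = sym (*-identityˡ (suc n)) , suc n / 2 , trans (halves (suc n)) (cong (_+ 2 * (suc n / 2)) r)
  ... | suc (suc _) | s≤s (s≤s ())

  n≡2^ν₂n*Θ₂n : ∀ {n} → 0 < n → n ≡ 2 ^ ν₂ n * Θ₂ n
  n≡2^ν₂n*Θ₂n {n} 0<n = proj₁ (ν₂aux-Θ₂aux-decomposition n n 0<n ≤-refl)

  Θ₂-odd : ∀ {n} → 0 < n → Odd (Θ₂ n)
  Θ₂-odd {n} 0<n = proj₂ (ν₂aux-Θ₂aux-decomposition n n 0<n ≤-refl)

  Θ₂-2^a*odd : ∀ a {u} → Odd u → Θ₂ (2 ^ a * u) ≡ u
  Θ₂-2^a*odd a {u} odd-u = sym (2^a*odd-injective a (ν₂ n) (n≡2^ν₂n*Θ₂n 0<n) odd-u (Θ₂-odd 0<n))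
    where
    n = 2 ^ a * u
    0<n : 0 < n
    0<n = *-mono-≤ (m^n>0 2 a) (Odd⇒>0 odd-u)

  Θ₂-* : ∀ {m n} → 0 < m → 0 < n → Θ₂ (m * n) ≡ Θ₂ m * Θ₂ n
  Θ₂-* {m} {n} 0<m 0<n = begin
    Θ₂ (m * n)
      ≡⟨ cong Θ₂ (cong₂ _*_ (n≡2^ν₂n*Θ₂n 0<m) (n≡2^ν₂n*Θ₂n 0<n)) ⟩
    Θ₂ ((2 ^ ν₂ m * Θ₂ m) * (2 ^ ν₂ n * Θ₂ n))
      ≡⟨ cong Θ₂ (interchange (2 ^ ν₂ m) (2 ^ ν₂ n) (Θ₂ m) (Θ₂ n)) ⟩
    Θ₂ ((2 ^ ν₂ m * 2 ^ ν₂ n) * (Θ₂ m * Θ₂ n))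
      ≡⟨ cong (λ p → Θ₂ (p * (Θ₂ m * Θ₂ n))) (sym (^-distribˡ-+-* 2 (ν₂ m) (ν₂ n))) ⟩
    Θ₂ (2 ^ (ν₂ m + ν₂ n) * (Θ₂ m * Θ₂ n))
      ≡⟨ Θ₂-2^a*odd (ν₂ m + ν₂ n) (Odd-* (Θ₂-odd 0<m) (Θ₂-odd 0<n)) ⟩
    Θ₂ m * Θ₂ n
      ∎
    where
    open ≡-Reasoning
    interchange : ∀ p q a b → (p * a) * (q * b) ≡ (p * q) * (a * b)
    interchange = solve-∀

  ν₂-≤ : ∀ {i j} → 0 < j → j ≤ 2 ^ i → ν₂ j ≤ i
  ν₂-≤ {i} {j} 0<j j≤2^i with ν₂ j ≤? i
  ... | yes ν≤i = ν≤i
  ... | no  ν≰i = ⊥-elim (<⇒≱ (^-monoʳ-< 2 (s≤s (s≤s z≤n)) (≰⇒> ν≰i)) (≤-trans 2^ν≤j j≤2^i))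
    where
    2^ν≤j : 2 ^ ν₂ j ≤ j
    2^ν≤j = subst (2 ^ ν₂ j ≤_) (sym (n≡2^ν₂n*Θ₂n 0<j))
              (m≤m*n (2 ^ ν₂ j) (Θ₂ j) {{>-nonZero (Odd⇒>0 (Θ₂-odd 0<j))}})

module OddPartOfFactorials where

  open OddPart
  open import Data.Nat
  open import Data.Nat.Properties
  open import Data.Product using (_,_)
  open import Data.List using (List; []; _∷_; [_]; _++_; map; upTo)
  open import Data.List.Properties using (map-++; map-∘; map-cong-local; upTo-∷ʳ)
  open import Data.List.Relation.Unary.All using (All; []; _∷_)
  open import Data.List.Relation.Unary.All.Properties using (applyUpTo⁺₁; applyUpTo⁺₂; map⁺)
  open import Data.Nat.ListAction using (product)
  open import Data.Nat.ListAction.Properties using (product-++)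
  open import Data.Vec using (Vec; []; _∷_)
  open import Function using (_∘_)
  open import Relation.Binary.PropositionalEquality hiding ([_])
  open import Data.Nat.Tactic.RingSolver using (solve-∀)

  Θ₂-2^[1+i]*x+j : ∀ i x {j} → 0 < j → j ≤ 2 ^ i →
    Θ₂ (2 ^ suc i * x + j) ≡ 2 ^ (suc i ∸ ν₂ j) * x + Θ₂ j
  Θ₂-2^[1+i]*x+j i x {j} 0<j j≤2^i = begin
    Θ₂ (2 ^ suc i * x + j)
      ≡⟨ cong Θ₂ (cong₂ (λ p q → p * x + q) 2^[1+i]≡2^ν*2^s (n≡2^ν₂n*Θ₂n 0<j)) ⟩
    Θ₂ (2 ^ ν * 2 ^ s * x + 2 ^ ν * Θ₂ j)        ≡⟨ cong Θ₂ (factor (2 ^ ν) (2 ^ s) x (Θ₂ j)) ⟩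
    Θ₂ (2 ^ ν * (2 ^ s * x + Θ₂ j))              ≡⟨ Θ₂-2^a*odd ν odd ⟩
    2 ^ s * x + Θ₂ j                             ∎
    where
    open ≡-Reasoning
    ν = ν₂ j
    s = suc i ∸ ν
    ν≤i : ν ≤ i
    ν≤i = ν₂-≤ 0<j j≤2^i
    2^[1+i]≡2^ν*2^s : 2 ^ suc i ≡ 2 ^ ν * 2 ^ s
    2^[1+i]≡2^ν*2^s = trans (cong (2 ^_) (sym (m+[n∸m]≡n (m≤n⇒m≤1+n ν≤i)))) (^-distribˡ-+-* 2 ν s)
    factor : ∀ p q x t → p * q * x + p * t ≡ p * (q * x + t)
    factor = solve-∀
    -- s ≥ 1 because ν ≤ i, so 2 ^ s * x is even.
    odd : Odd (2 ^ s * x + Θ₂ j)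
    odd with Θ₂-odd 0<j | +-∸-assoc 1 ν≤i
    ... | k , Θ≡1+2k | s≡1+[i∸ν] = 2 ^ (i ∸ ν) * x + k , (begin
      2 ^ s * x + Θ₂ j                          ≡⟨ cong₂ (λ e t → 2 ^ e * x + t) s≡1+[i∸ν] Θ≡1+2k ⟩
      2 * 2 ^ (i ∸ ν) * x + (1 + 2 * k)         ≡⟨ regroup (2 ^ (i ∸ ν)) x k ⟩
      1 + 2 * (2 ^ (i ∸ ν) * x + k)             ∎)
      where
      regroup : ∀ p x k → 2 * p * x + (1 + 2 * k) ≡ 1 + 2 * (p * x + k)
      regroup = solve-∀

  product>0 : ∀ {ns} → All (0 <_) ns → 0 < product ns
  product>0 []         = z<s
  product>0 (n>0 ∷ ns>0) = *-mono-≤ n>0 (product>0 ns>0)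

  Θ₂-product : ∀ {ns} → All (0 <_) ns → Θ₂ (product ns) ≡ product (map Θ₂ ns)
  Θ₂-product []           = refl
  Θ₂-product {n ∷ _} (n>0 ∷ ns>0) = trans (Θ₂-* n>0 (product>0 ns>0)) (cong (Θ₂ n *_) (Θ₂-product ns>0))

  [N+m]!≡N!*∏ : ∀ N m → (N + m) ! ≡ N ! * product (map (λ j → N + suc j) (upTo m))
  [N+m]!≡N!*∏ N zero    = trans (cong _! (+-identityʳ N)) (sym (*-identityʳ (N !)))
  [N+m]!≡N!*∏ N (suc m) = begin
    (N + suc m) !                              ≡⟨ cong _! (+-suc N m) ⟩
    suc (N + m) * (N + m) !                    ≡⟨ cong (suc (N + m) *_) ([N+m]!≡N!*∏ N m) ⟩
    suc (N + m) * (N ! * ∏ (upTo m))           ≡⟨ rearrange (suc (N + m)) (N !) (∏ (upTo m)) ⟩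
    N ! * (∏ (upTo m) * (suc (N + m) * 1))     ≡⟨ cong (λ t → N ! * (∏ (upTo m) * (t * 1))) (sym (+-suc N m)) ⟩
    N ! * (∏ (upTo m) * ∏ [ m ])               ≡⟨ cong (N ! *_) (sym (product-++ (map f (upTo m)) [ f m ])) ⟩
    N ! * product (map f (upTo m) ++ [ f m ])  ≡⟨ cong (λ l → N ! * product l) (sym (map-++ f (upTo m) [ m ])) ⟩
    N ! * ∏ (upTo m ++ [ m ])                  ≡⟨ cong (λ l → N ! * ∏ l) (upTo-∷ʳ m) ⟩
    N ! * ∏ (upTo (suc m))                     ∎
    where
    open ≡-Reasoning
    f : ℕ → ℕ
    f j = N + suc j
    ∏ : List ℕ → ℕ
    ∏ l = product (map f l)
    rearrange : ∀ a b c → a * (b * c) ≡ b * (c * (a * 1))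
    rearrange = solve-∀

  Ψℕ : ℕ → ℕ → ℕ
  Ψℕ i x = product (map (λ j → 2 ^ (suc i ∸ ν₂ j) * x + Θ₂ j) (map suc (upTo (2 ^ i))))

  Θ₂-[2^i*[1+2x]]! : ∀ i x → Θ₂ ((2 ^ i * (1 + 2 * x)) !) ≡ Θ₂ ((2 ^ suc i * x) !) * Ψℕ i x
  Θ₂-[2^i*[1+2x]]! i x = begin
    Θ₂ ((2 ^ i * (1 + 2 * x)) !)                 ≡⟨ cong (λ t → Θ₂ (t !)) (expand (2 ^ i) x) ⟩
    Θ₂ ((N + m) !)                               ≡⟨ cong Θ₂ ([N+m]!≡N!*∏ N m) ⟩
    Θ₂ (N ! * product (map g (upTo m)))          ≡⟨ Θ₂-* (1≤n! N) (product>0 g>0) ⟩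
    Θ₂ (N !) * Θ₂ (product (map g (upTo m)))     ≡⟨ cong (Θ₂ (N !) *_) (Θ₂-product g>0) ⟩
    Θ₂ (N !) * product (map Θ₂ (map g (upTo m))) ≡⟨ cong (λ l → Θ₂ (N !) * product l) (sym (map-∘ (upTo m))) ⟩
    Θ₂ (N !) * product (map (Θ₂ ∘ g) (upTo m))   ≡⟨ cong (λ l → Θ₂ (N !) * product l) (map-cong-local Θ₂∘g≡F∘suc) ⟩
    Θ₂ (N !) * product (map (F ∘ suc) (upTo m))  ≡⟨ cong (λ l → Θ₂ (N !) * product l) (map-∘ (upTo m)) ⟩
    Θ₂ (N !) * Ψℕ i x                            ∎
    where
    open ≡-Reasoning
    N = 2 ^ suc i * x
    m = 2 ^ i
    g F : ℕ → ℕ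
    g j = N + suc j
    F j = 2 ^ (suc i ∸ ν₂ j) * x + Θ₂ j
    expand : ∀ p x → p * (1 + 2 * x) ≡ 2 * p * x + p
    expand = solve-∀
    g>0 : All (0 <_) (map g (upTo m))
    g>0 = map⁺ (applyUpTo⁺₂ _ m (λ j → ≤-trans (s≤s z≤n) (m≤n+m (suc j) N)))
    Θ₂∘g≡F∘suc : All (λ j → Θ₂ (g j) ≡ F (suc j)) (upTo m)
    Θ₂∘g≡F∘suc = applyUpTo⁺₁ _ m (λ j<m → Θ₂-2^[1+i]*x+j i x z<s j<m)

  Θ₂-[2^i*[a+2x]]! : ∀ i x {a} → a ≤ 1 → Θ₂ ((2 ^ i * (a + 2 * x)) !) ≡ Θ₂ ((2 ^ suc i * x) !) * Ψℕ i x ^ a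
  Θ₂-[2^i*[a+2x]]! i x z≤n       =
    trans (cong (λ t → Θ₂ (t !)) (regroup (2 ^ i) x)) (sym (*-identityʳ _))
    where
    regroup : ∀ p x → p * (2 * x) ≡ 2 * p * x
    regroup = solve-∀
  Θ₂-[2^i*[a+2x]]! i x (s≤s z≤n) =
    trans (Θ₂-[2^i*[1+2x]]! i x) (cong (Θ₂ ((2 ^ suc i * x) !) *_) (sym (*-identityʳ (Ψℕ i x))))

  Ψvecℕ : ∀ {m} → ℕ → Vec ℕ m → ℕ → ℕ
  Ψvecℕ i []       x = 1
  Ψvecℕ i (f ∷ fs) x = Ψℕ i x ^ f * Ψvecℕ (suc i) fs x

  factorWeight : ∀ {m} → ℕ → Vec ℕ m → ℕ → ℕ
  factorWeight i []       x = 1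
  factorWeight i (f ∷ fs) x = Θ₂ ((2 ^ i * x) !) ^ f * factorWeight (suc i) fs x

  ^-distribʳ-* : ∀ m n k → (m * n) ^ k ≡ m ^ k * n ^ k
  ^-distribʳ-* m n zero    = refl
  ^-distribʳ-* m n (suc k) = trans (cong (m * n *_) (^-distribʳ-* m n k)) (interchange m n (m ^ k) (n ^ k))
    where
    interchange : ∀ a b c d → a * b * (c * d) ≡ a * c * (b * d)
    interchange = solve-∀

  weight-from-split : ∀ {m} i (fs : Vec ℕ m) x y → weight-from i fs x y ≡ factorWeight i fs x * factorWeight i fs y
  weight-from-split i []       x y = refl
  weight-from-split i (f ∷ fs) x y = begin
    (Θx * Θy) ^ f * weight-from (suc i) fs x y
                                                         ≡⟨ cong₂ _*_ (^-distribʳ-* Θx Θy f) (weight-from-split (suc i) fs x y) ⟩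
    Θx ^ f * Θy ^ f * (factorWeight (suc i) fs x * factorWeight (suc i) fs y)
                                                         ≡⟨ interchange (Θx ^ f) (Θy ^ f) _ _ ⟩
    factorWeight i (f ∷ fs) x * factorWeight i (f ∷ fs) y ∎
    where
    open ≡-Reasoning
    Θx = Θ₂ ((2 ^ i * x) !)
    Θy = Θ₂ ((2 ^ i * y) !)
    interchange : ∀ a b c d → a * b * (c * d) ≡ a * c * (b * d)
    interchange = solve-∀

  factorWeight-digit : ∀ {m} i (fs : Vec ℕ m) x {a} → a ≤ 1 →
    factorWeight i fs (a + 2 * x) ≡ factorWeight (suc i) fs x * Ψvecℕ i fs x ^ a
  factorWeight-digit i []       x {a} _   = sym (trans (*-identityˡ (1 ^ a)) (^-zeroˡ a))
  factorWeight-digit i (f ∷ fs) x {a} a≤1 = begin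
    Θ₂ ((2 ^ i * (a + 2 * x)) !) ^ f * factorWeight (suc i) fs (a + 2 * x)
      ≡⟨ cong₂ (λ u v → u ^ f * v) (Θ₂-[2^i*[a+2x]]! i x a≤1) (factorWeight-digit (suc i) fs x a≤1) ⟩
    (Θ * P ^ a) ^ f * (W * V ^ a)
      ≡⟨ cong (_* (W * V ^ a)) (^-distribʳ-* Θ (P ^ a) f) ⟩
    Θ ^ f * (P ^ a) ^ f * (W * V ^ a)
      ≡⟨ cong (λ t → Θ ^ f * t * (W * V ^ a)) (^-comm P a f) ⟩
    Θ ^ f * (P ^ f) ^ a * (W * V ^ a)
      ≡⟨ interchange (Θ ^ f) ((P ^ f) ^ a) W (V ^ a) ⟩
    Θ ^ f * W * ((P ^ f) ^ a * V ^ a)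
      ≡⟨ cong (Θ ^ f * W *_) (sym (^-distribʳ-* (P ^ f) V a)) ⟩
    Θ ^ f * W * (P ^ f * V) ^ a
      ∎
    where
    open ≡-Reasoning
    Θ = Θ₂ ((2 ^ suc i * x) !)
    P = Ψℕ i x
    W = factorWeight (suc (suc i)) fs x
    V = Ψvecℕ (suc i) fs x
    ^-comm : ∀ m a b → (m ^ a) ^ b ≡ (m ^ b) ^ a
    ^-comm m a b = trans (^-*-assoc m a b) (trans (cong (m ^_) (*-comm a b)) (sym (^-*-assoc m b a)))
    interchange : ∀ a b c d → a * b * (c * d) ≡ a * c * (b * d)
    interchange = solve-∀

  weight-from-digits : ∀ {m} (fs : Vec ℕ m) x y {a b} → a ≤ 1 → b ≤ 1 →
    weight-from 0 fs (a + 2 * x) (b + 2 * y) ≡ weight-from 0 (0 ∷ fs) x y * Ψvecℕ 0 fs x ^ a * Ψvecℕ 0 fs y ^ b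
  weight-from-digits fs x y {a} {b} a≤1 b≤1 = begin
    weight-from 0 fs (a + 2 * x) (b + 2 * y)
      ≡⟨ weight-from-split 0 fs _ _ ⟩
    factorWeight 0 fs (a + 2 * x) * factorWeight 0 fs (b + 2 * y)
      ≡⟨ cong₂ _*_ (factorWeight-digit 0 fs x a≤1) (factorWeight-digit 0 fs y b≤1) ⟩
    factorWeight 1 fs x * Ψvecℕ 0 fs x ^ a * (factorWeight 1 fs y * Ψvecℕ 0 fs y ^ b)
      ≡⟨ regroup (factorWeight 1 fs x) (factorWeight 1 fs y) (Ψvecℕ 0 fs x ^ a) (Ψvecℕ 0 fs y ^ b) ⟩
    1 * (factorWeight 1 fs x * factorWeight 1 fs y) * Ψvecℕ 0 fs x ^ a * Ψvecℕ 0 fs y ^ b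
      ≡⟨ cong (λ w → 1 * w * Ψvecℕ 0 fs x ^ a * Ψvecℕ 0 fs y ^ b) (sym (weight-from-split 1 fs x y)) ⟩
    weight-from 0 (0 ∷ fs) x y * Ψvecℕ 0 fs x ^ a * Ψvecℕ 0 fs y ^ b
      ∎
    where
    open ≡-Reasoning
    regroup : ∀ wx wy u v → wx * u * (wy * v) ≡ 1 * (wx * wy) * u * v
    regroup = solve-∀

module PairSums where

  open import Data.Nat as ℕ using (ℕ; zero; suc; _≤_; z≤n; s≤s)
  import Data.Nat.Properties as ℕ
  open import Data.Nat.DivMod using (_/_; _%_; [m+kn]%n≡m%n; m*n/n≡m; m<n⇒m%n≡m; m<n⇒m/n≡0; +-distrib-/-∣ʳ)
  open import Data.Nat.Divisibility using (divides)
  open import Data.Integer using (ℤ; +_; _+_; _*_)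
  open import Data.Integer.Properties using (+-identityˡ; +-assoc; *-zeroʳ; *-distribˡ-+)
  open import Data.Bool using (Bool; true; false; _∧_; if_then_else_; T?)
  open import Data.Bool.Properties using (∧-assoc; ∧-identityʳ)
  open import Data.List using ([]; _∷_; [_]; _++_; map; filter; concatMap; applyUpTo; upTo; length)
  open import Data.List.Properties using (map-++; map-∘; map-cong; length-++)
  open import Data.Product using (_×_; _,_; proj₁; proj₂)
  open import Function using (_∘_)
  open import Relation.Binary.PropositionalEquality hiding ([_])
  open import Data.Integer.Tactic.RingSolver using (solve-∀)

  when : Bool → ℤ → ℤ
  when b v = if b then v else + 0

  sumBelow : ℕ → (ℕ → ℤ) → ℤ
  sumBelow zero    F = + 0
  sumBelow (suc n) F = F 0 + sumBelow n (F ∘ suc)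

  sumBelow-cong : ∀ n {F G : ℕ → ℤ} → (∀ k → F k ≡ G k) → sumBelow n F ≡ sumBelow n G
  sumBelow-cong zero    F≡G = refl
  sumBelow-cong (suc n) F≡G = cong₂ _+_ (F≡G 0) (sumBelow-cong n (F≡G ∘ suc))

  sumBelow-+ : ∀ n (F G : ℕ → ℤ) → sumBelow n (λ k → F k + G k) ≡ sumBelow n F + sumBelow n G
  sumBelow-+ zero    F G = refl
  sumBelow-+ (suc n) F G =
    trans (cong (_+_ (F 0 + G 0)) (sumBelow-+ n (F ∘ suc) (G ∘ suc))) (interchange (F 0) (G 0) _ _)
    where
    interchange : ∀ a b c d → a + b + (c + d) ≡ a + c + (b + d)
    interchange = solve-∀

  sumBelow-double : ∀ m (F : ℕ → ℤ) → sumBelow (2 ℕ.* m) F ≡ sumBelow m (λ x → F (2 ℕ.* x) + F (1 ℕ.+ 2 ℕ.* x))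
  sumBelow-double zero    F = refl
  sumBelow-double (suc m) F = begin
    sumBelow (2 ℕ.* suc m) F
      ≡⟨ cong (λ n → sumBelow n F) (2[1+m] m) ⟩
    F 0 + (F 1 + sumBelow (2 ℕ.* m) (F ∘ suc ∘ suc))
      ≡⟨ cong (λ s → F 0 + (F 1 + s)) (sumBelow-double m (F ∘ suc ∘ suc)) ⟩
    F 0 + (F 1 + sumBelow m (λ x → F (2 ℕ.+ 2 ℕ.* x) + F (3 ℕ.+ 2 ℕ.* x)))
      ≡⟨ sym (+-assoc (F 0) (F 1) _) ⟩
    F 0 + F 1 + sumBelow m (λ x → F (2 ℕ.+ 2 ℕ.* x) + F (3 ℕ.+ 2 ℕ.* x))
      ≡⟨ cong (_+_ (F 0 + F 1))
              (sumBelow-cong m (λ x → cong₂ (λ u v → F u + F v) (sym (2[1+m] x)) (cong suc (sym (2[1+m] x))))) ⟩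
    sumBelow (suc m) (λ x → F (2 ℕ.* x) + F (1 ℕ.+ 2 ℕ.* x))
      ∎
    where
    open ≡-Reasoning
    2[1+m] : ∀ m → 2 ℕ.* suc m ≡ 2 ℕ.+ 2 ℕ.* m
    2[1+m] m = cong suc (ℕ.+-suc m (m ℕ.+ 0))

  sumℤ-++ : ∀ xs ys → sumℤ (xs ++ ys) ≡ sumℤ xs + sumℤ ys
  sumℤ-++ []       ys = sym (+-identityˡ _)
  sumℤ-++ (x ∷ xs) ys = trans (cong (_+_ x) (sumℤ-++ xs ys)) (sym (+-assoc x _ _))

  sumℤ-map-scale : ∀ {A : Set} c (F : A → ℤ) xs → sumℤ (map (λ a → c * F a) xs) ≡ c * sumℤ (map F xs)
  sumℤ-map-scale c F []       = sym (*-zeroʳ c)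
  sumℤ-map-scale c F (x ∷ xs) = trans (cong (_+_ (c * F x)) (sumℤ-map-scale c F xs)) (sym (*-distribˡ-+ c (F x) _))

  sumℤ-applyUpTo : ∀ n (g : ℕ → ℕ) (F : ℕ → ℤ) → sumℤ (map F (applyUpTo g n)) ≡ sumBelow n (F ∘ g)
  sumℤ-applyUpTo zero    g F = refl
  sumℤ-applyUpTo (suc n) g F = cong (_+_ (F (g 0))) (sumℤ-applyUpTo n (g ∘ suc) F)

  sumℤ-filter : ∀ {A : Set} (b : A → Bool) (F : A → ℤ) xs →
    sumℤ (map F (filter (T? ∘ b) xs)) ≡ sumℤ (map (λ a → when (b a) (F a)) xs)
  sumℤ-filter b F [] = refl
  sumℤ-filter b F (x ∷ xs) with b x
  ... | true  = cong (_+_ (F x)) (sumℤ-filter b F xs)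
  ... | false = trans (sumℤ-filter b F xs) (sym (+-identityˡ _))

  sumℤ-concatMap-pairs : ∀ {A B : Set} (F : A × B → ℤ) xs ys →
    sumℤ (map F (concatMap (λ x → map (x ,_) ys) xs)) ≡ sumℤ (map (λ x → sumℤ (map (λ y → F (x , y)) ys)) xs)
  sumℤ-concatMap-pairs F []       ys = refl
  sumℤ-concatMap-pairs F (x ∷ xs) ys = begin
    sumℤ (map F (map (x ,_) ys ++ concatMap (λ x → map (x ,_) ys) xs))
      ≡⟨ cong sumℤ (map-++ F (map (x ,_) ys) _) ⟩
    sumℤ (map F (map (x ,_) ys) ++ map F (concatMap (λ x → map (x ,_) ys) xs))
      ≡⟨ sumℤ-++ (map F (map (x ,_) ys)) _ ⟩
    sumℤ (map F (map (x ,_) ys)) + sumℤ (map F (concatMap (λ x → map (x ,_) ys) xs))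
      ≡⟨ cong₂ _+_ (cong sumℤ (sym (map-∘ ys))) (sumℤ-concatMap-pairs F xs ys) ⟩
    sumℤ (map (λ y → F (x , y)) ys) + sumℤ (map (λ x → sumℤ (map (λ y → F (x , y)) ys)) xs)
      ∎
    where open ≡-Reasoning

  digit-% : ∀ {a} x → a ≤ 1 → (a ℕ.+ 2 ℕ.* x) % 2 ≡ a
  digit-% {a} x a≤1 = trans (cong (λ t → (a ℕ.+ t) % 2) (ℕ.*-comm 2 x))
    (trans ([m+kn]%n≡m%n a x 2) (m<n⇒m%n≡m (s≤s a≤1)))

  digit-/ : ∀ {a} x → a ≤ 1 → (a ℕ.+ 2 ℕ.* x) / 2 ≡ x
  digit-/ {a} x a≤1 = begin
    (a ℕ.+ 2 ℕ.* x) / 2   ≡⟨ cong (λ t → (a ℕ.+ t) / 2) (ℕ.*-comm 2 x) ⟩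
    (a ℕ.+ x ℕ.* 2) / 2   ≡⟨ +-distrib-/-∣ʳ a (divides x refl) ⟩
    a / 2 ℕ.+ x ℕ.* 2 / 2 ≡⟨ cong₂ ℕ._+_ (m<n⇒m/n≡0 (s≤s a≤1)) (m*n/n≡m x 2) ⟩
    x                     ∎
    where open ≡-Reasoning

  matches-snoc : ∀ T I x y → matches (T ++ [ I ]) x y ≡ matches T (x / 2) (y / 2) ∧ columnOK I (x % 2) (y % 2)
  matches-snoc []      I x y = ∧-identityʳ _
  matches-snoc (J ∷ T) I x y = trans
    (cong₂ (λ n m → columnOK J (bit x n) (bit y n) ∧ m) (trans (length-++ T) (ℕ.+-comm _ 1)) (matches-snoc T I x y))
    (sym (∧-assoc (columnOK J (bit (x / 2) (length T)) (bit (y / 2) (length T))) _ _))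

  matches-digits : ∀ T I x y {a b} → a ≤ 1 → b ≤ 1 →
    matches (T ++ [ I ]) (a ℕ.+ 2 ℕ.* x) (b ℕ.+ 2 ℕ.* y) ≡ matches T x y ∧ columnOK I a b
  matches-digits T I x y a≤1 b≤1 = trans (matches-snoc T I _ _)
    (cong₂ _∧_ (cong₂ (matches T) (digit-/ x a≤1) (digit-/ y b≤1)) (cong₂ (columnOK I) (digit-% x a≤1) (digit-% y b≤1)))

  columnSum : Letter → (ℕ → ℕ → ℤ) → ℤ
  columnSum I h = (when (columnOK I 0 0) (h 0 0) + when (columnOK I 0 1) (h 0 1))
                + (when (columnOK I 1 0) (h 1 0) + when (columnOK I 1 1) (h 1 1))

  columnSum-cong : ∀ I {h h' : ℕ → ℕ → ℤ} → (∀ {a b} → a ≤ 1 → b ≤ 1 → h a b ≡ h' a b) →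
    columnSum I h ≡ columnSum I h'
  columnSum-cong I h≡h' = cong₂ _+_ (cong₂ _+_ (digit z≤n z≤n) (digit z≤n (s≤s z≤n)))
                                    (cong₂ _+_ (digit (s≤s z≤n) z≤n) (digit (s≤s z≤n) (s≤s z≤n)))
    where
    digit : ∀ {a b} → a ≤ 1 → b ≤ 1 → when (columnOK I a b) _ ≡ when (columnOK I a b) _
    digit a≤1 b≤1 = cong (when (columnOK I _ _)) (h≡h' a≤1 b≤1)

  columnSum-*ʳ : ∀ I (h : ℕ → ℕ → ℤ) w → columnSum I (λ a b → h a b * w) ≡ columnSum I h * w
  columnSum-*ʳ I h w = trans
    (cong₂ _+_ (cong₂ _+_ (when-* (columnOK I 0 0) (h 0 0)) (when-* (columnOK I 0 1) (h 0 1)))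
               (cong₂ _+_ (when-* (columnOK I 1 0) (h 1 0)) (when-* (columnOK I 1 1) (h 1 1))))
    (distribute (when (columnOK I 0 0) (h 0 0)) (when (columnOK I 0 1) (h 0 1))
                (when (columnOK I 1 0) (h 1 0)) (when (columnOK I 1 1) (h 1 1)) w)
    where
    when-* : ∀ β v → when β (v * w) ≡ when β v * w
    when-* true  v = refl
    when-* false v = refl
    distribute : ∀ a b c d w → a * w + b * w + (c * w + d * w) ≡ (a + b + (c + d)) * w
    distribute = solve-∀

  typeSum : Word → (ℕ → ℕ → ℤ) → ℤ
  typeSum T G = sumℤ (map (λ p → G (proj₁ p) (proj₂ p)) (pairsOfType T))

  typeSum-cong : ∀ T {G H : ℕ → ℕ → ℤ} → (∀ x y → G x y ≡ H x y) → typeSum T G ≡ typeSum T H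
  typeSum-cong T G≡H = cong sumℤ (map-cong (λ p → G≡H (proj₁ p) (proj₂ p)) (pairsOfType T))

  typeSum-scale : ∀ T c (G : ℕ → ℕ → ℤ) → typeSum T (λ x y → c * G x y) ≡ c * typeSum T G
  typeSum-scale T c G = sumℤ-map-scale c (λ p → G (proj₁ p) (proj₂ p)) (pairsOfType T)

  typeSum≡sumBelow² : ∀ T G → let N = 2 ℕ.^ length T in
    typeSum T G ≡ sumBelow N (λ x → sumBelow N (λ y → when (matches T x y) (G x y)))
  typeSum≡sumBelow² T G = begin
    typeSum T G
      ≡⟨ sumℤ-filter (λ p → matches T (proj₁ p) (proj₂ p)) (λ p → G (proj₁ p) (proj₂ p)) pairs ⟩
    sumℤ (map H pairs)
      ≡⟨ sumℤ-concatMap-pairs H (upTo N) (upTo N) ⟩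
    sumℤ (map (λ x → sumℤ (map (λ y → H (x , y)) (upTo N))) (upTo N))
      ≡⟨ sumℤ-applyUpTo N (λ k → k) _ ⟩
    sumBelow N (λ x → sumℤ (map (λ y → H (x , y)) (upTo N)))
      ≡⟨ sumBelow-cong N (λ x → sumℤ-applyUpTo N (λ k → k) _) ⟩
    sumBelow N (λ x → sumBelow N (λ y → when (matches T x y) (G x y)))
      ∎
    where
    open ≡-Reasoning
    N = 2 ℕ.^ length T
    pairs = concatMap (λ x → map (x ,_) (upTo N)) (upTo N)
    H : ℕ × ℕ → ℤ
    H p = when (matches T (proj₁ p) (proj₂ p)) (G (proj₁ p) (proj₂ p))

  sumBelow²-double : ∀ m (H : ℕ → ℕ → ℤ) →
    sumBelow (2 ℕ.* m) (λ x → sumBelow (2 ℕ.* m) (H x)) ≡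
    sumBelow m (λ x → sumBelow m (λ y →
      (H (2 ℕ.* x) (2 ℕ.* y) + H (2 ℕ.* x) (1 ℕ.+ 2 ℕ.* y))
      + (H (1 ℕ.+ 2 ℕ.* x) (2 ℕ.* y) + H (1 ℕ.+ 2 ℕ.* x) (1 ℕ.+ 2 ℕ.* y))))
  sumBelow²-double m H = begin
    sumBelow (2 ℕ.* m) (λ x → sumBelow (2 ℕ.* m) (H x))
      ≡⟨ sumBelow-cong (2 ℕ.* m) (λ x → sumBelow-double m (H x)) ⟩
    sumBelow (2 ℕ.* m) (λ x → sumBelow m (λ y → H x (2 ℕ.* y) + H x (1 ℕ.+ 2 ℕ.* y)))
      ≡⟨ sumBelow-double m _ ⟩
    sumBelow m (λ x → sumBelow m (λ y → H (2 ℕ.* x) (2 ℕ.* y) + H (2 ℕ.* x) (1 ℕ.+ 2 ℕ.* y))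
                    + sumBelow m (λ y → H (1 ℕ.+ 2 ℕ.* x) (2 ℕ.* y) + H (1 ℕ.+ 2 ℕ.* x) (1 ℕ.+ 2 ℕ.* y)))
      ≡⟨ sumBelow-cong m (λ x → sym (sumBelow-+ m _ _)) ⟩
    _ ∎
    where open ≡-Reasoning

  when-∧-columnSum : ∀ β I h →
    (when (β ∧ columnOK I 0 0) (h 0 0) + when (β ∧ columnOK I 0 1) (h 0 1))
    + (when (β ∧ columnOK I 1 0) (h 1 0) + when (β ∧ columnOK I 1 1) (h 1 1))
    ≡ when β (columnSum I h)
  when-∧-columnSum true  I h = refl
  when-∧-columnSum false I h = refl

  typeSum-snoc : ∀ T I G →
    typeSum (T ++ [ I ]) G ≡ typeSum T (λ x y → columnSum I (λ a b → G (a ℕ.+ 2 ℕ.* x) (b ℕ.+ 2 ℕ.* y)))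
  typeSum-snoc T I G = begin
    typeSum (T ++ [ I ]) G
      ≡⟨ typeSum≡sumBelow² (T ++ [ I ]) G ⟩
    sumBelow (2 ℕ.^ length (T ++ [ I ])) (λ x → sumBelow (2 ℕ.^ length (T ++ [ I ])) (H x))
      ≡⟨ cong (λ n → sumBelow (2 ℕ.^ n) (λ x → sumBelow (2 ℕ.^ n) (H x))) (trans (length-++ T) (ℕ.+-comm _ 1)) ⟩
    sumBelow (2 ℕ.* N) (λ x → sumBelow (2 ℕ.* N) (H x))
      ≡⟨ sumBelow²-double N H ⟩
    sumBelow N (λ x → sumBelow N (λ y → _))
      ≡⟨ sumBelow-cong N (λ x → sumBelow-cong N (λ y → lastColumn x y)) ⟩
    sumBelow N (λ x → sumBelow N (λ y → when (matches T x y) (columnSum I (λ a b → G (a ℕ.+ 2 ℕ.* x) (b ℕ.+ 2 ℕ.* y)))))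
      ≡⟨ sym (typeSum≡sumBelow² T _) ⟩
    typeSum T (λ x y → columnSum I (λ a b → G (a ℕ.+ 2 ℕ.* x) (b ℕ.+ 2 ℕ.* y)))
      ∎
    where
    open ≡-Reasoning
    N = 2 ℕ.^ length T
    H : ℕ → ℕ → ℤ
    H x y = when (matches (T ++ [ I ]) x y) (G x y)
    lastColumn : ∀ x y →
      (H (2 ℕ.* x) (2 ℕ.* y) + H (2 ℕ.* x) (1 ℕ.+ 2 ℕ.* y))
      + (H (1 ℕ.+ 2 ℕ.* x) (2 ℕ.* y) + H (1 ℕ.+ 2 ℕ.* x) (1 ℕ.+ 2 ℕ.* y))
      ≡ when (matches T x y) (columnSum I (λ a b → G (a ℕ.+ 2 ℕ.* x) (b ℕ.+ 2 ℕ.* y)))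
    lastColumn x y = trans
      (cong₂ _+_ (cong₂ _+_ (digits z≤n z≤n) (digits z≤n 1≤1)) (cong₂ _+_ (digits 1≤1 z≤n) (digits 1≤1 1≤1)))
      (when-∧-columnSum (matches T x y) I (λ a b → G (a ℕ.+ 2 ℕ.* x) (b ℕ.+ 2 ℕ.* y)))
      where
      1≤1 : 1 ≤ 1
      1≤1 = s≤s z≤n
      digits : ∀ {a b} → a ≤ 1 → b ≤ 1 → H (a ℕ.+ 2 ℕ.* x) (b ℕ.+ 2 ℕ.* y)
               ≡ when (matches T x y ∧ columnOK I a b) (G (a ℕ.+ 2 ℕ.* x) (b ℕ.+ 2 ℕ.* y))
      digits a≤1 b≤1 = cong (λ β → when β _) (matches-digits T I x y a≤1 b≤1)

module Polynomials where

  open import Data.Nat as ℕ using (ℕ; zero; suc; z<s)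
  import Data.Nat.Properties as ℕ
  open import Data.Integer using (ℤ; +_; _+_; _*_; _^_)
  open import Data.Integer.Properties using (+-identityˡ; +-identityʳ; *-zeroʳ; *-identityʳ; pos-+; pos-*; ^-zeroˡ)
  open import Data.List using (List; []; _∷_; map; upTo)
  open import Data.Vec using (Vec; []; _∷_)
  open import Data.List.Relation.Unary.All using (All; []; _∷_)
  open import Data.List.Relation.Unary.All.Properties using (applyUpTo⁺₁; map⁺)
  open import Data.Product using (Σ; _×_; _,_)
  open import Relation.Binary.PropositionalEquality
  open import Data.Integer.Tactic.RingSolver using (solve-∀)
  open OddPart using (Θ₂-odd; ν₂-≤)

  -- Coefficient lists, constant term first.
  horner : List ℤ → ℤ → ℤ
  horner []       x = + 0
  horner (a ∷ as) x = a + x * horner as x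

  Polynomial : (ℤ → ℤ) → Set
  Polynomial f = Σ (List ℤ) λ as → ∀ x → horner as x ≡ f x

  infixl 6 _⊕_
  _⊕_ : List ℤ → List ℤ → List ℤ
  []       ⊕ bs       = bs
  (a ∷ as) ⊕ []       = a ∷ as
  (a ∷ as) ⊕ (b ∷ bs) = (a + b) ∷ (as ⊕ bs)

  infixl 7 _⊛_
  _⊛_ : List ℤ → List ℤ → List ℤ
  []       ⊛ bs = []
  (a ∷ as) ⊛ bs = map (a *_) bs ⊕ (+ 0 ∷ as ⊛ bs)

  horner-⊕ : ∀ as bs x → horner (as ⊕ bs) x ≡ horner as x + horner bs x
  horner-⊕ []       bs       x = sym (+-identityˡ _)
  horner-⊕ (a ∷ as) []       x = sym (+-identityʳ _)
  horner-⊕ (a ∷ as) (b ∷ bs) x = trans (cong (λ t → a + b + x * t) (horner-⊕ as bs x)) (distribute a b x _ _)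
    where
    distribute : ∀ a b x u v → a + b + x * (u + v) ≡ a + x * u + (b + x * v)
    distribute = solve-∀

  horner-scale : ∀ c as x → horner (map (c *_) as) x ≡ c * horner as x
  horner-scale c []       x = sym (*-zeroʳ c)
  horner-scale c (a ∷ as) x = trans (cong (λ t → c * a + x * t) (horner-scale c as x)) (distribute c a x _)
    where
    distribute : ∀ c a x u → c * a + x * (c * u) ≡ c * (a + x * u)
    distribute = solve-∀

  horner-⊛ : ∀ as bs x → horner (as ⊛ bs) x ≡ horner as x * horner bs x
  horner-⊛ []       bs x = refl
  horner-⊛ (a ∷ as) bs x = begin
    horner (map (a *_) bs ⊕ (+ 0 ∷ as ⊛ bs)) x          ≡⟨ horner-⊕ (map (a *_) bs) _ x ⟩
    horner (map (a *_) bs) x + (+ 0 + x * horner (as ⊛ bs) x)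
      ≡⟨ cong₂ (λ u v → u + (+ 0 + x * v)) (horner-scale a bs x) (horner-⊛ as bs x) ⟩
    a * horner bs x + (+ 0 + x * (horner as x * horner bs x))
                                                        ≡⟨ distribute a x (horner as x) (horner bs x) ⟩
    (a + x * horner as x) * horner bs x                 ∎
    where
    open ≡-Reasoning
    distribute : ∀ a x u v → a * v + (+ 0 + x * (u * v)) ≡ (a + x * u) * v
    distribute = solve-∀

  polynomial-const : ∀ c → Polynomial (λ _ → c)
  polynomial-const c = c ∷ [] , λ x → trans (cong (_+_ c) (*-zeroʳ x)) (+-identityʳ c)

  polynomial-id : Polynomial (λ x → x)
  polynomial-id = + 0 ∷ + 1 ∷ [] , λ x → trans (+-identityˡ _) (trans (cong (λ t → x * (+ 1 + t)) (*-zeroʳ x)) (*-identityʳ x))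

  polynomial-+ : ∀ {f g} → Polynomial f → Polynomial g → Polynomial (λ x → f x + g x)
  polynomial-+ (as , as≡f) (bs , bs≡g) = as ⊕ bs , λ x → trans (horner-⊕ as bs x) (cong₂ _+_ (as≡f x) (bs≡g x))

  polynomial-* : ∀ {f g} → Polynomial f → Polynomial g → Polynomial (λ x → f x * g x)
  polynomial-* (as , as≡f) (bs , bs≡g) = as ⊛ bs , λ x → trans (horner-⊛ as bs x) (cong₂ _*_ (as≡f x) (bs≡g x))

  polynomial-^ : ∀ {f} → Polynomial f → ∀ k → Polynomial (λ x → f x ^ k)
  polynomial-^ pf zero    = polynomial-const (+ 1)
  polynomial-^ pf (suc k) = polynomial-* pf (polynomial-^ pf k)

  polynomial-prodℤ : ∀ {A : Set} {F : A → ℤ → ℤ} → (∀ a → Polynomial (F a)) →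
    ∀ as → Polynomial (λ x → prodℤ (map (λ a → F a x) as))
  polynomial-prodℤ pF []       = polynomial-const (+ 1)
  polynomial-prodℤ pF (a ∷ as) = polynomial-* (pF a) (polynomial-prodℤ pF as)

  polynomial-affine : ∀ a b → Polynomial (λ x → a * x + b)
  polynomial-affine a b = polynomial-+ (polynomial-* (polynomial-const a) polynomial-id) (polynomial-const b)

  polynomial-Ψ : ∀ i → Polynomial (Ψ i)
  polynomial-Ψ i =
    polynomial-prodℤ (λ j → polynomial-affine (+ (2 ℕ.^ (suc i ℕ.∸ ν₂ j))) (+ Θ₂ j)) (map suc (upTo (2 ℕ.^ i)))

  polynomial-Ψvec-from : ∀ {m} i (fs : Vec ℕ m) → Polynomial (Ψvec-from i fs)
  polynomial-Ψvec-from i []       = polynomial-const (+ 1)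
  polynomial-Ψvec-from i (f ∷ fs) = polynomial-* (polynomial-^ (polynomial-Ψ i) f) (polynomial-Ψvec-from (suc i) fs)

  ConstantMod2 : (ℤ → ℤ) → ℤ → Set
  ConstantMod2 f d = Σ (ℤ → ℤ) λ h → Polynomial h × (∀ x → f x ≡ d + + 2 * h x)

  constantMod2-one : ConstantMod2 (λ _ → + 1) (+ 1)
  constantMod2-one = (λ _ → + 0) , polynomial-const (+ 0) , λ _ → refl

  constantMod2-resp : ∀ {f d e} → d ≡ e → ConstantMod2 f d → ConstantMod2 f e
  constantMod2-resp refl c = c

  constantMod2-* : ∀ {f g a b} → ConstantMod2 f a → ConstantMod2 g b → ConstantMod2 (λ x → f x * g x) (a * b)
  constantMod2-* {a = a} {b} (h , ph , f≡) (k , pk , g≡) =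
    (λ x → a * k x + h x * b + + 2 * h x * k x) ,
    polynomial-+ (polynomial-+ (polynomial-* (polynomial-const a) pk) (polynomial-* ph (polynomial-const b)))
                 (polynomial-* (polynomial-* (polynomial-const (+ 2)) ph) pk) ,
    λ x → trans (cong₂ _*_ (f≡ x) (g≡ x)) (expand a b (h x) (k x))
    where
    expand : ∀ a b u v → (a + + 2 * u) * (b + + 2 * v) ≡ a * b + + 2 * (a * v + u * b + + 2 * u * v)
    expand = solve-∀

  constantMod2-^ : ∀ {f d} → ConstantMod2 f d → ∀ k → ConstantMod2 (λ x → f x ^ k) (d ^ k)
  constantMod2-^ c zero    = constantMod2-one
  constantMod2-^ {d = d} c (suc k) = constantMod2-* {a = d} {b = d ^ k} c (constantMod2-^ c k)

  constantMod2-prodℤ : ∀ {A : Set} {F : A → ℤ → ℤ} {as} → All (λ a → ConstantMod2 (F a) (+ 1)) as →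
    ConstantMod2 (λ x → prodℤ (map (λ a → F a x) as)) (+ 1)
  constantMod2-prodℤ []       = constantMod2-one
  constantMod2-prodℤ (c ∷ cs) = constantMod2-* {a = + 1} {b = + 1} c (constantMod2-prodℤ cs)

  constantMod2-Ψ-factor : ∀ i {j} → 0 ℕ.< j → j ℕ.≤ 2 ℕ.^ i →
    ConstantMod2 (λ x → + (2 ℕ.^ (suc i ℕ.∸ ν₂ j)) * x + + Θ₂ j) (+ 1)
  constantMod2-Ψ-factor i {j} 0<j j≤2^i with Θ₂-odd 0<j | ℕ.+-∸-assoc 1 (ν₂-≤ 0<j j≤2^i)
  ... | k , Θ≡1+2k | s≡1+t =
    (λ x → + (2 ℕ.^ t) * x + + k) , polynomial-affine (+ (2 ℕ.^ t)) (+ k) , λ x → begin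
      + (2 ℕ.^ (suc i ℕ.∸ ν₂ j)) * x + + Θ₂ j     ≡⟨ cong₂ (λ e θ → + (2 ℕ.^ e) * x + + θ) s≡1+t Θ≡1+2k ⟩
      + (2 ℕ.* 2 ℕ.^ t) * x + + (1 ℕ.+ 2 ℕ.* k)   ≡⟨ cong₂ (λ p q → p * x + q) (pos-* 2 (2 ℕ.^ t)) +[1+2k] ⟩
      + 2 * + (2 ℕ.^ t) * x + (+ 1 + + 2 * + k)   ≡⟨ regroup (+ (2 ℕ.^ t)) x (+ k) ⟩
      + 1 + + 2 * (+ (2 ℕ.^ t) * x + + k)         ∎
    where
    open ≡-Reasoning
    t = i ℕ.∸ ν₂ j
    +[1+2k] : + (1 ℕ.+ 2 ℕ.* k) ≡ + 1 + + 2 * + k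
    +[1+2k] = trans (pos-+ 1 (2 ℕ.* k)) (cong (_+_ (+ 1)) (pos-* 2 k))
    regroup : ∀ p x k → + 2 * p * x + (+ 1 + + 2 * k) ≡ + 1 + + 2 * (p * x + k)
    regroup = solve-∀

  constantMod2-Ψ : ∀ i → ConstantMod2 (Ψ i) (+ 1)
  constantMod2-Ψ i = constantMod2-prodℤ (map⁺ (applyUpTo⁺₁ _ (2 ℕ.^ i) (constantMod2-Ψ-factor i z<s)))

  constantMod2-Ψvec-from : ∀ {m} i (fs : Vec ℕ m) → ConstantMod2 (Ψvec-from i fs) (+ 1)
  constantMod2-Ψvec-from i []       = constantMod2-one
  constantMod2-Ψvec-from i (f ∷ fs) =
    constantMod2-* {a = + 1} {b = + 1} (constantMod2-resp (^-zeroˡ f) (constantMod2-^ (constantMod2-Ψ i) f))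
                                       (constantMod2-Ψvec-from (suc i) fs)

module SeparablePolynomials where

  open import Data.Nat as ℕ using (ℕ; zero; suc; _≤_; s≤s)
  import Data.Nat.Properties as ℕ
  open import Data.Integer using (ℤ; +_; _+_; _*_; _^_)
  open import Data.Integer.Properties using (+-identityˡ; +-comm; *-zeroˡ; *-zeroʳ; *-identityʳ; *-comm; *-assoc; *-distribˡ-+)
  open import Data.Fin using (Fin; toℕ) renaming (zero to fz; suc to fs)
  open import Data.List using (List; []; _∷_; length)
  open import Data.Product using (proj₁; proj₂)
  open import Relation.Binary.PropositionalEquality
  open import Data.Integer.Tactic.RingSolver using (solve-∀)
  open Polynomials

  sumFin-cong : ∀ {n} {f g : Fin n → ℤ} → (∀ i → f i ≡ g i) → sumFin f ≡ sumFin g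
  sumFin-cong {zero}  f≡g = refl
  sumFin-cong {suc n} f≡g = cong₂ _+_ (f≡g fz) (sumFin-cong (λ i → f≡g (fs i)))

  sumFin-0 : ∀ n → sumFin {n} (λ _ → + 0) ≡ + 0
  sumFin-0 zero    = refl
  sumFin-0 (suc n) = trans (+-identityˡ _) (sumFin-0 n)

  sumFin-+ : ∀ {n} (f g : Fin n → ℤ) → sumFin (λ i → f i + g i) ≡ sumFin f + sumFin g
  sumFin-+ {zero}  f g = refl
  sumFin-+ {suc n} f g = trans (cong (_+_ (f fz + g fz)) (sumFin-+ (λ i → f (fs i)) (λ i → g (fs i))))
    (interchange (f fz) (g fz) _ _)
    where
    interchange : ∀ a b c d → a + b + (c + d) ≡ a + c + (b + d)
    interchange = solve-∀

  sumFin-scale : ∀ {n} c (f : Fin n → ℤ) → sumFin (λ i → c * f i) ≡ c * sumFin f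
  sumFin-scale {zero}  c f = sym (*-zeroʳ c)
  sumFin-scale {suc n} c f =
    trans (cong (_+_ (c * f fz)) (sumFin-scale c (λ i → f (fs i)))) (sym (*-distribˡ-+ c (f fz) _))

  sumFin-swap : ∀ {m n} (f : Fin m → Fin n → ℤ) →
    sumFin (λ i → sumFin (λ j → f i j)) ≡ sumFin (λ j → sumFin (λ i → f i j))
  sumFin-swap {zero}  {n} f = sym (sumFin-0 n)
  sumFin-swap {suc m}     f = trans (cong (_+_ (sumFin (f fz))) (sumFin-swap (λ i → f (fs i))))
    (sym (sumFin-+ (f fz) (λ j → sumFin (λ i → f (fs i) j))))

  coeffAt : List ℤ → ℕ → ℤ
  coeffAt []       k       = + 0
  coeffAt (a ∷ as) zero    = a
  coeffAt (a ∷ as) (suc k) = coeffAt as k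

  horner≡sumFin : ∀ N as x → length as ≤ N → sumFin {N} (λ k → coeffAt as (toℕ k) * x ^ toℕ k) ≡ horner as x
  horner≡sumFin N       []       x _ = trans (sumFin-cong {N} (λ k → *-zeroˡ (x ^ toℕ k))) (sumFin-0 N)
  horner≡sumFin (suc N) (a ∷ as) x (s≤s as≤N) = cong₂ _+_ (*-identityʳ a) (begin
    sumFin {N} (λ k → coeffAt as (toℕ k) * (x * x ^ toℕ k))
      ≡⟨ sumFin-cong {N} (λ k → commute (coeffAt as (toℕ k)) x (x ^ toℕ k)) ⟩
    sumFin {N} (λ k → x * (coeffAt as (toℕ k) * x ^ toℕ k))
      ≡⟨ sumFin-scale {N} x _ ⟩
    x * sumFin {N} (λ k → coeffAt as (toℕ k) * x ^ toℕ k)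
      ≡⟨ cong (x *_) (horner≡sumFin N as x as≤N) ⟩
    x * horner as x
      ∎)
    where
    open ≡-Reasoning
    commute : ∀ c x u → c * (x * u) ≡ x * (c * u)
    commute = solve-∀

  sumFin² : ∀ {m n} → (Fin m → Fin n → ℤ) → ℤ
  sumFin² f = sumFin (λ i → sumFin (λ j → f i j))

  sumFin²-cong : ∀ {m n} {f g : Fin m → Fin n → ℤ} → (∀ i j → f i j ≡ g i j) → sumFin² f ≡ sumFin² g
  sumFin²-cong f≡g = sumFin-cong (λ i → sumFin-cong (f≡g i))

  sumFin²-+ : ∀ {m n} (f g : Fin m → Fin n → ℤ) → sumFin² (λ i j → f i j + g i j) ≡ sumFin² f + sumFin² g
  sumFin²-+ f g = trans (sumFin-cong (λ i → sumFin-+ (f i) (g i))) (sumFin-+ (λ i → sumFin (f i)) (λ i → sumFin (g i)))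

  sumFin²-scale : ∀ {m n} k (f : Fin m → Fin n → ℤ) → sumFin² (λ i j → k * f i j) ≡ k * sumFin² f
  sumFin²-scale k f = trans (sumFin-cong (λ i → sumFin-scale k (f i))) (sumFin-scale k (λ i → sumFin (f i)))

  eval-+ : ∀ {N} (c d : Fin N → Fin N → ℤ) x y →
    eval (poly2 N (λ p q → c p q + d p q)) x y ≡ eval (poly2 N c) x y + eval (poly2 N d) x y
  eval-+ c d x y = trans (sumFin²-cong (λ p q → distribute (c p q) (d p q) (x ^ toℕ p) (y ^ toℕ q)))
    (sumFin²-+ (λ p q → c p q * x ^ toℕ p * y ^ toℕ q) (λ p q → d p q * x ^ toℕ p * y ^ toℕ q))
    where
    distribute : ∀ a b u v → (a + b) * u * v ≡ a * u * v + b * u * v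
    distribute = solve-∀

  eval-scale : ∀ {N} k (c : Fin N → Fin N → ℤ) x y → eval (poly2 N (λ p q → k * c p q)) x y ≡ k * eval (poly2 N c) x y
  eval-scale k c x y = trans (sumFin²-cong (λ p q → reassociate k (c p q) (x ^ toℕ p) (y ^ toℕ q)))
    (sumFin²-scale k (λ p q → c p q * x ^ toℕ p * y ^ toℕ q))
    where
    reassociate : ∀ k a u v → k * a * u * v ≡ k * (a * u * v)
    reassociate = solve-∀

  eval-sumFin : ∀ {N n} (c : Fin n → Fin N → Fin N → ℤ) x y →
    eval (poly2 N (λ p q → sumFin (λ i → c i p q))) x y ≡ sumFin (λ i → eval (poly2 N (c i)) x y)
  eval-sumFin {N} c x y = begin
    sumFin² (λ p q → sumFin (λ i → c i p q) * X p * Y q)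
      ≡⟨ sumFin²-cong (λ p q → trans (cong (_* Y q) (sumFin-scaleʳ (X p) (λ i → c i p q)))
                                     (sumFin-scaleʳ (Y q) (λ i → c i p q * X p))) ⟩
    sumFin² (λ p q → sumFin (λ i → c i p q * X p * Y q))
      ≡⟨ sumFin-cong (λ p → sumFin-swap (λ q i → c i p q * X p * Y q)) ⟩
    sumFin (λ p → sumFin (λ i → sumFin (λ q → c i p q * X p * Y q)))
      ≡⟨ sumFin-swap (λ p i → sumFin (λ q → c i p q * X p * Y q)) ⟩
    sumFin (λ i → eval (poly2 N (c i)) x y)
      ∎
    where
    open ≡-Reasoning
    X Y : Fin N → ℤ
    X p = x ^ toℕ p
    Y q = y ^ toℕ q
    sumFin-scaleʳ : ∀ {n} k (f : Fin n → ℤ) → sumFin f * k ≡ sumFin (λ i → f i * k)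
    sumFin-scaleʳ k f = trans (*-comm (sumFin f) k) (trans (sym (sumFin-scale k f)) (sumFin-cong (λ i → *-comm k (f i))))

  eval-outer : ∀ N as bs x y → length as ≤ N → length bs ≤ N →
    eval (poly2 N (λ p q → coeffAt as (toℕ p) * coeffAt bs (toℕ q))) x y ≡ horner as x * horner bs y
  eval-outer N as bs x y as≤N bs≤N = begin
    sumFin² (λ p q → a p * b q * X p * Y q)   ≡⟨ sumFin²-cong (λ p q → regroup (a p) (b q) (X p) (Y q)) ⟩
    sumFin² (λ p q → (a p * X p) * (b q * Y q)) ≡⟨ sumFin-cong (λ p → sumFin-scale (a p * X p) (λ q → b q * Y q)) ⟩
    sumFin (λ p → (a p * X p) * sumFin (λ q → b q * Y q))
                                                ≡⟨ sumFin-cong (λ p → *-comm (a p * X p) _) ⟩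
    sumFin (λ p → sumFin (λ q → b q * Y q) * (a p * X p))
                                                ≡⟨ sumFin-scale (sumFin (λ q → b q * Y q)) (λ p → a p * X p) ⟩
    sumFin (λ q → b q * Y q) * sumFin (λ p → a p * X p)
                                                ≡⟨ *-comm _ (sumFin (λ p → a p * X p)) ⟩
    sumFin (λ p → a p * X p) * sumFin (λ q → b q * Y q)
                                                ≡⟨ cong₂ _*_ (horner≡sumFin N as x as≤N) (horner≡sumFin N bs y bs≤N) ⟩
    horner as x * horner bs y                   ∎
    where
    open ≡-Reasoning
    a b X Y : Fin N → ℤ
    a p = coeffAt as (toℕ p)
    b q = coeffAt bs (toℕ q)
    X p = x ^ toℕ p
    Y q = y ^ toℕ q
    regroup : ∀ a b u v → a * b * u * v ≡ (a * u) * (b * v)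
    regroup = solve-∀

  separable : ∀ {n} → (Fin n → Fin n → ℤ) → (A B : Fin n → List ℤ) → ∀ N → Fin N → Fin N → ℤ
  separable c A B N p q = sumFin² (λ i j → c i j * (coeffAt (A i) (toℕ p) * coeffAt (B j) (toℕ q)))

  eval-separable : ∀ {n} (c : Fin n → Fin n → ℤ) A B N x y → (∀ i → length (A i) ≤ N) → (∀ i → length (B i) ≤ N) →
    eval (poly2 N (separable c A B N)) x y ≡ sumFin² (λ i j → c i j * horner (A i) x * horner (B j) y)
  eval-separable c A B N x y A≤N B≤N = begin
    eval (poly2 N (separable c A B N)) x y
      ≡⟨ eval-sumFin (λ i p q → sumFin (λ j → term i j p q)) x y ⟩
    sumFin (λ i → eval (poly2 N (λ p q → sumFin (λ j → term i j p q))) x y)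
      ≡⟨ sumFin-cong (λ i → eval-sumFin (term i) x y) ⟩
    sumFin² (λ i j → eval (poly2 N (term i j)) x y)
      ≡⟨ sumFin²-cong (λ i j → eval-scale (c i j) (λ p q → a i p * b j q) x y) ⟩
    sumFin² (λ i j → c i j * eval (poly2 N (λ p q → a i p * b j q)) x y)
      ≡⟨ sumFin²-cong (λ i j → cong (c i j *_) (eval-outer N (A i) (B j) x y (A≤N i) (B≤N j))) ⟩
    sumFin² (λ i j → c i j * (horner (A i) x * horner (B j) y))
      ≡⟨ sumFin²-cong (λ i j → sym (*-assoc (c i j) _ _)) ⟩
    sumFin² (λ i j → c i j * horner (A i) x * horner (B j) y)
      ∎
    where
    open ≡-Reasoning
    a b : _ → Fin N → ℤ
    a i p = coeffAt (A i) (toℕ p)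
    b j q = coeffAt (B j) (toℕ q)
    term : _ → _ → Fin N → Fin N → ℤ
    term i j p q = c i j * (a i p * b j q)

  separable-swap : ∀ {n} {c : Fin n → Fin n → ℤ} → (∀ i j → c i j ≡ c j i) → ∀ A B N p q →
    separable c A B N p q ≡ separable c B A N q p
  separable-swap {c = c} c-sym A B N p q =
    trans (sumFin²-cong (λ i j → cong₂ _*_ (c-sym i j) (*-comm (coeffAt (A i) (toℕ p)) (coeffAt (B j) (toℕ q)))))
      (sumFin-swap (λ i j → c j i * (coeffAt (B j) (toℕ q) * coeffAt (A i) (toℕ p))))

  width : ∀ {n} → (Fin n → List ℤ) → ℕ
  width {zero}  A = 0
  width {suc n} A = length (A fz) ℕ.⊔ width (λ i → A (fs i))

  length≤width : ∀ {n} (A : Fin n → List ℤ) i → length (A i) ≤ width A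
  length≤width A fz     = ℕ.m≤m⊔n _ _
  length≤width A (fs i) = ℕ.≤-trans (length≤width (λ i → A (fs i)) i) (ℕ.m≤n⊔m (length (A fz)) _)

  coefficientsOf : ∀ {n} {A : Fin n → ℤ → ℤ} → (∀ i → Polynomial (A i)) → Fin n → List ℤ
  coefficientsOf pA i = proj₁ (pA i)

  eval-separableOf : ∀ {n} (c : Fin n → Fin n → ℤ) {A B : Fin n → ℤ → ℤ}
    (pA : ∀ i → Polynomial (A i)) (pB : ∀ i → Polynomial (B i)) N x y →
    (∀ i → length (coefficientsOf pA i) ≤ N) → (∀ i → length (coefficientsOf pB i) ≤ N) →
    eval (poly2 N (separable c (coefficientsOf pA) (coefficientsOf pB) N)) x y ≡ sumFin² (λ i j → c i j * A i x * B j y)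
  eval-separableOf c pA pB N x y A≤N B≤N = trans (eval-separable c (coefficientsOf pA) (coefficientsOf pB) N x y A≤N B≤N)
    (sumFin²-cong (λ i j → cong₂ (λ u v → c i j * u * v) (proj₂ (pA i) x) (proj₂ (pB j) y)))

  separablePoly : ∀ {n} (c : Fin n → Fin n → ℤ) {A : Fin n → ℤ → ℤ} → (∀ i → Polynomial (A i)) → Poly2
  separablePoly c pA = poly2 N (separable c (coefficientsOf pA) (coefficientsOf pA) N)
    where N = width (coefficientsOf pA)

  separablePoly-symmetric : ∀ {n} {c : Fin n → Fin n → ℤ} → (∀ i j → c i j ≡ c j i) →
    ∀ {A : Fin n → ℤ → ℤ} (pA : ∀ i → Polynomial (A i)) → SymmetricPoly (separablePoly c pA)
  separablePoly-symmetric c-sym pA = separable-swap c-sym (coefficientsOf pA) (coefficientsOf pA) (width (coefficientsOf pA))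

  eval-separablePoly : ∀ {n} (c : Fin n → Fin n → ℤ) {A : Fin n → ℤ → ℤ} (pA : ∀ i → Polynomial (A i)) x y →
    eval (separablePoly c pA) x y ≡ sumFin² (λ i j → c i j * A i x * A j y)
  eval-separablePoly c pA x y = eval-separableOf c pA pA _ x y (length≤width _) (length≤width _)

  symmetrized : ∀ {n} → (Fin n → Fin n → ℤ) → (A B : Fin n → List ℤ) → ∀ N → Fin N → Fin N → ℤ
  symmetrized c A B N p q = separable c A B N p q + separable c B A N p q

  symmetrized-swap : ∀ {n} {c : Fin n → Fin n → ℤ} → (∀ i j → c i j ≡ c j i) → ∀ A B N p q →
    symmetrized c A B N p q ≡ symmetrized c A B N q p
  symmetrized-swap {c = c} c-sym A B N p q =
    trans (cong₂ _+_ (separable-swap c-sym A B N p q) (separable-swap c-sym B A N p q))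
      (+-comm (separable c B A N q p) (separable c A B N q p))

open import Data.Nat as ℕ using (ℕ; zero; suc; _≤_; _⊔_)
import Data.Nat.Properties as ℕ
open import Data.Nat.ListAction using (product)
open import Data.Integer using (ℤ; +_; _+_; _*_; _^_)
open import Data.Integer.Properties using (pos-+; pos-*; +-identityˡ; +-comm; *-identityˡ; *-assoc; ^-zeroˡ)
open import Data.Fin using (Fin; toℕ)
open import Data.List using (List; []; _∷_; map; upTo; length; _++_; [_])
open import Data.Vec using (Vec; []; _∷_)
open import Data.Product using (Σ; _×_; _,_; proj₁; proj₂)
open import Relation.Binary.PropositionalEquality hiding ([_])
open import Data.Integer.Tactic.RingSolver using (solve-∀)
open OddPartOfFactorials using (Ψℕ; Ψvecℕ; weight-from-digits)
open PairSums
open Polynomials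
open SeparablePolynomials

pos-^ : ∀ m k → + (m ℕ.^ k) ≡ (+ m) ^ k
pos-^ m zero    = refl
pos-^ m (suc k) = trans (pos-* m (m ℕ.^ k)) (cong (+ m *_) (pos-^ m k))

prodℤ-map-pos : ∀ {A : Set} (F : A → ℤ) (f : A → ℕ) → (∀ a → F a ≡ + f a) →
  ∀ as → prodℤ (map F as) ≡ + product (map f as)
prodℤ-map-pos F f F≡f []       = refl
prodℤ-map-pos F f F≡f (a ∷ as) =
  trans (cong₂ _*_ (F≡f a) (prodℤ-map-pos F f F≡f as)) (sym (pos-* (f a) (product (map f as))))

Ψ-pos : ∀ i x → Ψ i (+ x) ≡ + Ψℕ i x
Ψ-pos i x = prodℤ-map-pos _ _
  (λ j → trans (cong (_+ + Θ₂ j) (sym (pos-* (2 ℕ.^ (suc i ℕ.∸ ν₂ j)) x))) (sym (pos-+ _ (Θ₂ j))))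
  (map suc (Data.List.upTo (2 ℕ.^ i)))

Ψvec-from-pos : ∀ {m} i (fs : Vec ℕ m) x → Ψvec-from i fs (+ x) ≡ + Ψvecℕ i fs x
Ψvec-from-pos i []       x = refl
Ψvec-from-pos i (f ∷ fs) x =
  trans (cong₂ _*_ (trans (cong (_^ f) (Ψ-pos i x)) (sym (pos-^ (Ψℕ i x) f))) (Ψvec-from-pos (suc i) fs x))
        (sym (pos-* (Ψℕ i x ℕ.^ f) (Ψvecℕ (suc i) fs x)))

weight-digits : ∀ {m} (fs : Vec ℕ m) x y {a b} → a ≤ 1 → b ≤ 1 →
  + weight-from 0 fs (a ℕ.+ 2 ℕ.* x) (b ℕ.+ 2 ℕ.* y)
  ≡ + weight-from 0 (0 ∷ fs) x y * Ψᵉ fs (+ x) ^ a * Ψᵉ fs (+ y) ^ b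
weight-digits fs x y {a} {b} a≤1 b≤1 = begin
  + weight-from 0 fs (a ℕ.+ 2 ℕ.* x) (b ℕ.+ 2 ℕ.* y)
    ≡⟨ cong +_ (weight-from-digits fs x y a≤1 b≤1) ⟩
  + (w ℕ.* Ψvecℕ 0 fs x ℕ.^ a ℕ.* Ψvecℕ 0 fs y ℕ.^ b)
    ≡⟨ trans (pos-* (w ℕ.* Ψvecℕ 0 fs x ℕ.^ a) _) (cong (_* + (Ψvecℕ 0 fs y ℕ.^ b)) (pos-* w _)) ⟩
  + w * + (Ψvecℕ 0 fs x ℕ.^ a) * + (Ψvecℕ 0 fs y ℕ.^ b)
    ≡⟨ cong₂ (λ u v → + w * u * v) (power x a) (power y b) ⟩
  + w * Ψᵉ fs (+ x) ^ a * Ψᵉ fs (+ y) ^ b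
    ∎
  where
  open ≡-Reasoning
  w = weight-from 0 (0 ∷ fs) x y
  power : ∀ z k → + (Ψvecℕ 0 fs z ℕ.^ k) ≡ Ψᵉ fs (+ z) ^ k
  power z k = trans (pos-^ (Ψvecℕ 0 fs z) k) (cong (_^ k) (sym (Ψvec-from-pos 0 fs z)))

-- The children (a + 2x, b + 2y) of (x, y) under the letter I, with the weight of (x, y) for 0 ∷ fs factored out.
digitColumn : ∀ {m} → Vec ℕ m → Letter → Poly2 → ℕ → ℕ → ℤ
digitColumn fs I R x y =
  columnSum I (λ a b → eval R (+ (a ℕ.+ 2 ℕ.* x)) (+ (b ℕ.+ 2 ℕ.* y)) * Ψᵉ fs (+ x) ^ a * Ψᵉ fs (+ y) ^ b)

𝔖-snoc : ∀ {m} (fs : Vec ℕ m) T I (R Q : Poly2) k →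
  (∀ x y → digitColumn fs I R x y ≡ k * eval Q (+ x) (+ y)) →
  𝔖 fs (T ++ [ I ]) R ≡ k * 𝔖 (0 ∷ fs) T Q
𝔖-snoc fs T I R Q k column≡kQ = begin
  𝔖 fs (T ++ [ I ]) R
    ≡⟨ typeSum-snoc T I (λ u v → eval R (+ u) (+ v) * + weight-from 0 fs u v) ⟩
  typeSum T (λ x y → columnSum I (λ a b → eval R (+ (a ℕ.+ 2 ℕ.* x)) (+ (b ℕ.+ 2 ℕ.* y))
                                          * + weight-from 0 fs (a ℕ.+ 2 ℕ.* x) (b ℕ.+ 2 ℕ.* y)))
    ≡⟨ typeSum-cong T pointwise ⟩
  typeSum T (λ x y → k * (eval Q (+ x) (+ y) * + weight-from 0 (0 ∷ fs) x y))
    ≡⟨ typeSum-scale T k (λ x y → eval Q (+ x) (+ y) * + weight-from 0 (0 ∷ fs) x y) ⟩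
  k * 𝔖 (0 ∷ fs) T Q
    ∎
  where
  open ≡-Reasoning
  pointwise : ∀ x y →
    columnSum I (λ a b → eval R (+ (a ℕ.+ 2 ℕ.* x)) (+ (b ℕ.+ 2 ℕ.* y))
                         * + weight-from 0 fs (a ℕ.+ 2 ℕ.* x) (b ℕ.+ 2 ℕ.* y))
    ≡ k * (eval Q (+ x) (+ y) * + weight-from 0 (0 ∷ fs) x y)
  pointwise x y = begin
    columnSum I (λ a b → r a b * + weight-from 0 fs (a ℕ.+ 2 ℕ.* x) (b ℕ.+ 2 ℕ.* y))
      ≡⟨ columnSum-cong I (λ {a} {b} a≤1 b≤1 → trans (cong (r a b *_) (weight-digits fs x y a≤1 b≤1))
                                                     (regroup (r a b) w (Ψᵉ fs (+ x) ^ a) (Ψᵉ fs (+ y) ^ b))) ⟩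
    columnSum I (λ a b → r a b * Ψᵉ fs (+ x) ^ a * Ψᵉ fs (+ y) ^ b * w)
      ≡⟨ columnSum-*ʳ I (λ a b → r a b * Ψᵉ fs (+ x) ^ a * Ψᵉ fs (+ y) ^ b) w ⟩
    columnSum I (λ a b → r a b * Ψᵉ fs (+ x) ^ a * Ψᵉ fs (+ y) ^ b) * w
      ≡⟨ cong (_* w) (column≡kQ x y) ⟩
    k * eval Q (+ x) (+ y) * w
      ≡⟨ *-assoc k _ w ⟩
    k * (eval Q (+ x) (+ y) * w)
      ∎
    where
    w = + weight-from 0 (0 ∷ fs) x y
    r : ℕ → ℕ → ℤ
    r a b = eval R (+ (a ℕ.+ 2 ℕ.* x)) (+ (b ℕ.+ 2 ℕ.* y))
    regroup : ∀ r w u v → r * (w * u * v) ≡ r * u * v * w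
    regroup = solve-∀

+[2x] : ∀ x → + (2 ℕ.* x) ≡ + 2 * + x
+[2x] = pos-* 2

+[1+2x] : ∀ x → + (1 ℕ.+ 2 ℕ.* x) ≡ + 2 * + x + + 1
+[1+2x] x = trans (pos-+ 1 (2 ℕ.* x)) (trans (cong (_+_ (+ 1)) (+[2x] x)) (+-comm (+ 1) (+ 2 * + x)))

module Construction (n : ℕ) (c : Fin n → Fin n → ℤ) (c-sym : ∀ i j → c i j ≡ c j i) {m} (e : Vec ℕ m) where

  P : Poly2
  P = poly2 n c

  G F : Fin n → ℤ → ℤ
  G i x = (+ 2 * x) ^ toℕ i
  F i x = Ψᵉ e x * (+ 2 * x + + 1) ^ toℕ i

  polynomial-G : ∀ i → Polynomial (G i)
  polynomial-G i = polynomial-^ (polynomial-* (polynomial-const (+ 2)) polynomial-id) (toℕ i)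

  polynomial-F : ∀ i → Polynomial (F i)
  polynomial-F i = polynomial-* (polynomial-Ψvec-from 0 e) (polynomial-^ (polynomial-affine (+ 2) (+ 1)) (toℕ i))

  QZ : Poly2
  QZ = separablePoly c polynomial-G

  QZ-symmetric : SymmetricPoly QZ
  QZ-symmetric = separablePoly-symmetric c-sym polynomial-G

  eval-QZ : ∀ x y → eval QZ x y ≡ eval P (+ 2 * x) (+ 2 * y)
  eval-QZ = eval-separablePoly c polynomial-G

  QO : Poly2
  QO = separablePoly c polynomial-F

  QO-symmetric : SymmetricPoly QO
  QO-symmetric = separablePoly-symmetric c-sym polynomial-F

  eval-QO : ∀ x y → eval QO x y ≡ Ψᵉ e x * Ψᵉ e y * eval P (+ 2 * x + + 1) (+ 2 * y + + 1)
  eval-QO x y = trans (eval-separablePoly c polynomial-F x y)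
    (trans (sumFin²-cong (λ i j → regroup (c i j) (Ψᵉ e x) (Ψᵉ e y) _ _))
           (sumFin²-scale (Ψᵉ e x * Ψᵉ e y) (λ i j → c i j * (+ 2 * x + + 1) ^ toℕ i * (+ 2 * y + + 1) ^ toℕ j)))
    where
    regroup : ∀ c a b u v → c * (a * u) * (b * v) ≡ a * b * (c * u * v)
    regroup = solve-∀

  d : Fin n → ℤ
  d j = (+ 0) ^ toℕ j

  G≡d+2g : ∀ j → ConstantMod2 (G j) (d j)
  G≡d+2g j = constantMod2-^ ((λ x → x) , polynomial-id , λ x → sym (+-identityˡ _)) (toℕ j)

  F≡1+2f : ∀ i → ConstantMod2 (F i) (+ 1)
  F≡1+2f i = constantMod2-* {a = + 1} {b = + 1} (constantMod2-Ψvec-from 0 e)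
    (constantMod2-resp (^-zeroˡ (toℕ i)) (constantMod2-^ ((λ x → x) , polynomial-id , λ x → +-comm (+ 2 * x) (+ 1)) (toℕ i)))

  f g : Fin n → ℤ → ℤ
  f i = proj₁ (F≡1+2f i)
  g j = proj₁ (G≡d+2g j)

  polynomial-f : ∀ i → Polynomial (f i)
  polynomial-f i = proj₁ (proj₂ (F≡1+2f i))

  polynomial-g : ∀ j → Polynomial (g j)
  polynomial-g j = proj₁ (proj₂ (G≡d+2g j))

  polynomial-d : ∀ j → Polynomial (λ _ → d j)
  polynomial-d j = polynomial-const (d j)

  polynomial-1 : Fin 1 → Polynomial (λ _ → + 1)
  polynomial-1 _ = polynomial-const (+ 1)

  K : ℤ
  K = sumFin² (λ i j → c i j * d j)

  N : ℕ
  N = width (coefficientsOf polynomial-f) ⊔ width (coefficientsOf polynomial-F) ⊔ width (coefficientsOf polynomial-g) ⊔ 1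

  -- Writing F_i(x) = 1 + 2 f_i(x) and G_j(y) = d_j + 2 g_j(y), with d_j = 0^j, the numerator
  -- Σ c_ij (F_i(x) G_j(y) + G_i(x) F_j(y)) is 2K plus twice the two symmetrized sums below.
  QM : Poly2
  QM = poly2 N (λ p q → separable (λ _ _ → K) (coefficientsOf polynomial-1) (coefficientsOf polynomial-1) N p q
                      + symmetrized c (coefficientsOf polynomial-f) (coefficientsOf polynomial-d) N p q
                      + symmetrized c (coefficientsOf polynomial-F) (coefficientsOf polynomial-g) N p q)

  QM-symmetric : SymmetricPoly QM
  QM-symmetric p q = cong₂ _+_
    (cong₂ _+_ (separable-swap {c = λ _ _ → K} (λ _ _ → refl) (coefficientsOf polynomial-1) (coefficientsOf polynomial-1) N p q)
               (symmetrized-swap c-sym (coefficientsOf polynomial-f) (coefficientsOf polynomial-d) N p q))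
    (symmetrized-swap c-sym (coefficientsOf polynomial-F) (coefficientsOf polynomial-g) N p q)

  private
    bound-1 : ∀ i → length (coefficientsOf polynomial-1 i) ℕ.≤ N
    bound-1 _ = ℕ.m≤n⊔m _ 1

    bound-d : ∀ j → length (coefficientsOf polynomial-d j) ℕ.≤ N
    bound-d _ = ℕ.m≤n⊔m _ 1

    bound-f : ∀ i → length (coefficientsOf polynomial-f i) ℕ.≤ N
    bound-f i = ℕ.m≤n⇒m≤n⊔o 1 (ℕ.m≤n⇒m≤n⊔o _ (ℕ.m≤n⇒m≤n⊔o _ (length≤width (coefficientsOf polynomial-f) i)))

    bound-F : ∀ i → length (coefficientsOf polynomial-F i) ℕ.≤ N
    bound-F i = ℕ.m≤n⇒m≤n⊔o 1 (ℕ.m≤n⇒m≤n⊔o _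
                  (ℕ.m≤n⇒m≤o⊔n (width (coefficientsOf polynomial-f)) (length≤width (coefficientsOf polynomial-F) i)))

    bound-g : ∀ j → length (coefficientsOf polynomial-g j) ℕ.≤ N
    bound-g j = ℕ.m≤n⇒m≤n⊔o 1 (ℕ.m≤n⇒m≤o⊔n _ (length≤width (coefficientsOf polynomial-g) j))

  Σcd≡K : sumFin² (λ i j → c i j * d i) ≡ K
  Σcd≡K = trans (sumFin-swap (λ i j → c i j * d i)) (sumFin²-cong (λ j i → cong (_* d i) (c-sym i j)))

  module _ (x y : ℤ) where
    private
      T₁ T₁' T₂ T₂' : ℤ
      T₁  = sumFin² (λ i j → c i j * f i x * d j)
      T₁' = sumFin² (λ i j → c i j * d i * f j y)
      T₂  = sumFin² (λ i j → c i j * F i x * g j y)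
      T₂' = sumFin² (λ i j → c i j * g i x * F j y)

      eval-QM-expanded : eval QM x y ≡ (K * + 1 * + 1 + + 0) + + 0 + (T₁ + T₁') + (T₂ + T₂')
      eval-QM-expanded = begin
        eval QM x y
          ≡⟨ eval-+ (λ p q → separable K₁ ones ones N p q + symmetrized c fs ds N p q) (symmetrized c Fs gs N) x y ⟩
        eval (poly2 N (λ p q → separable K₁ ones ones N p q + symmetrized c fs ds N p q)) x y
        + eval (poly2 N (symmetrized c Fs gs N)) x y
          ≡⟨ cong₂ _+_ (eval-+ (separable K₁ ones ones N) (symmetrized c fs ds N) x y)
                       (eval-+ (separable c Fs gs N) (separable c gs Fs N) x y) ⟩
        eval (poly2 N (separable K₁ ones ones N)) x y + eval (poly2 N (symmetrized c fs ds N)) x y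
          + (eval (poly2 N (separable c Fs gs N)) x y + eval (poly2 N (separable c gs Fs N)) x y)
          ≡⟨ cong₂ _+_ (cong₂ _+_ (eval-separableOf K₁ polynomial-1 polynomial-1 N x y bound-1 bound-1)
                                  (eval-+ (separable c fs ds N) (separable c ds fs N) x y))
                       (cong₂ _+_ (eval-separableOf c polynomial-F polynomial-g N x y bound-F bound-g)
                                  (eval-separableOf c polynomial-g polynomial-F N x y bound-g bound-F)) ⟩
        (K * + 1 * + 1 + + 0) + + 0 + (eval (poly2 N (separable c fs ds N)) x y + eval (poly2 N (separable c ds fs N)) x y) + (T₂ + T₂')
          ≡⟨ cong (λ t → (K * + 1 * + 1 + + 0) + + 0 + t + (T₂ + T₂'))
                  (cong₂ _+_ (eval-separableOf c polynomial-f polynomial-d N x y bound-f bound-d)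
                             (eval-separableOf c polynomial-d polynomial-f N x y bound-d bound-f)) ⟩
        (K * + 1 * + 1 + + 0) + + 0 + (T₁ + T₁') + (T₂ + T₂')
          ∎
        where
        open ≡-Reasoning
        K₁ : Fin 1 → Fin 1 → ℤ
        K₁ _ _ = K
        ones = coefficientsOf polynomial-1
        fs = coefficientsOf polynomial-f
        ds = coefficientsOf polynomial-d
        Fs = coefficientsOf polynomial-F
        gs = coefficientsOf polynomial-g

      numerator-split : sumFin² (λ i j → c i j * F i x * G j y + c i j * G i x * F j y)
                        ≡ (K + K) + + 2 * (T₁ + T₁') + + 2 * (T₂ + T₂')
      numerator-split = begin
        sumFin² (λ i j → c i j * F i x * G j y + c i j * G i x * F j y)
          ≡⟨ sumFin²-cong pointwise ⟩
        sumFin² (λ i j → (c i j * d j + c i j * d i) + + 2 * U₁ i j + + 2 * U₂ i j)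
          ≡⟨ sumFin²-+ (λ i j → (c i j * d j + c i j * d i) + + 2 * U₁ i j) (λ i j → + 2 * U₂ i j) ⟩
        sumFin² (λ i j → (c i j * d j + c i j * d i) + + 2 * U₁ i j) + sumFin² (λ i j → + 2 * U₂ i j)
          ≡⟨ cong₂ _+_ (sumFin²-+ (λ i j → c i j * d j + c i j * d i) (λ i j → + 2 * U₁ i j)) (sumFin²-scale (+ 2) U₂) ⟩
        sumFin² (λ i j → c i j * d j + c i j * d i) + sumFin² (λ i j → + 2 * U₁ i j) + + 2 * sumFin² U₂
          ≡⟨ cong₂ (λ a b → a + b + + 2 * sumFin² U₂)
                   (trans (sumFin²-+ (λ i j → c i j * d j) (λ i j → c i j * d i)) (cong (_+_ K) Σcd≡K))
                   (sumFin²-scale (+ 2) U₁) ⟩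
        (K + K) + + 2 * sumFin² U₁ + + 2 * sumFin² U₂
          ≡⟨ cong₂ (λ a b → (K + K) + + 2 * a + + 2 * b)
                   (sumFin²-+ (λ i j → c i j * f i x * d j) (λ i j → c i j * d i * f j y))
                   (sumFin²-+ (λ i j → c i j * F i x * g j y) (λ i j → c i j * g i x * F j y)) ⟩
        (K + K) + + 2 * (T₁ + T₁') + + 2 * (T₂ + T₂')
          ∎
        where
        open ≡-Reasoning
        U₁ U₂ : Fin n → Fin n → ℤ
        U₁ i j = c i j * f i x * d j + c i j * d i * f j y
        U₂ i j = c i j * F i x * g j y + c i j * g i x * F j y
        expand : ∀ c fi fj di dj gi gj →
          c * (+ 1 + + 2 * fi) * (dj + + 2 * gj) + c * (di + + 2 * gi) * (+ 1 + + 2 * fj)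
          ≡ (c * dj + c * di) + + 2 * (c * fi * dj + c * di * fj)
            + + 2 * (c * (+ 1 + + 2 * fi) * gj + c * gi * (+ 1 + + 2 * fj))
        expand = solve-∀
        pointwise : ∀ i j → c i j * F i x * G j y + c i j * G i x * F j y
                          ≡ (c i j * d j + c i j * d i) + + 2 * U₁ i j + + 2 * U₂ i j
        pointwise i j = begin
          c i j * F i x * G j y + c i j * G i x * F j y
            ≡⟨ cong₂ _+_ (cong₂ (λ u v → c i j * u * v) (Fx i) (Gy j)) (cong₂ (λ u v → c i j * u * v) (Gx i) (Fy j)) ⟩
          c i j * (+ 1 + + 2 * f i x) * (d j + + 2 * g j y) + c i j * (d i + + 2 * g i x) * (+ 1 + + 2 * f j y)
            ≡⟨ expand (c i j) (f i x) (f j y) (d i) (d j) (g i x) (g j y) ⟩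
          (c i j * d j + c i j * d i) + + 2 * U₁ i j
            + + 2 * (c i j * (+ 1 + + 2 * f i x) * g j y + c i j * g i x * (+ 1 + + 2 * f j y))
            ≡⟨ cong (λ t → (c i j * d j + c i j * d i) + + 2 * U₁ i j + + 2 * t)
                    (sym (cong₂ _+_ (cong (λ u → c i j * u * g j y) (Fx i)) (cong (c i j * g i x *_) (Fy j)))) ⟩
          (c i j * d j + c i j * d i) + + 2 * U₁ i j + + 2 * U₂ i j
            ∎
          where
          Fx : ∀ i → F i x ≡ + 1 + + 2 * f i x
          Fx i = proj₂ (proj₂ (F≡1+2f i)) x
          Fy : ∀ j → F j y ≡ + 1 + + 2 * f j y
          Fy j = proj₂ (proj₂ (F≡1+2f j)) y
          Gx : ∀ i → G i x ≡ d i + + 2 * g i x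
          Gx i = proj₂ (proj₂ (G≡d+2g i)) x
          Gy : ∀ j → G j y ≡ d j + + 2 * g j y
          Gy j = proj₂ (proj₂ (G≡d+2g j)) y

    eval-QM : + 2 * eval QM x y ≡ Ψᵉ e x * eval P (+ 2 * x + + 1) (+ 2 * y) + Ψᵉ e y * eval P (+ 2 * x) (+ 2 * y + + 1)
    eval-QM = begin
      + 2 * eval QM x y
        ≡⟨ cong (+ 2 *_) eval-QM-expanded ⟩
      + 2 * ((K * + 1 * + 1 + + 0) + + 0 + (T₁ + T₁') + (T₂ + T₂'))
        ≡⟨ double K T₁ T₁' T₂ T₂' ⟩
      (K + K) + + 2 * (T₁ + T₁') + + 2 * (T₂ + T₂')
        ≡⟨ sym numerator-split ⟩
      sumFin² (λ i j → c i j * F i x * G j y + c i j * G i x * F j y)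
        ≡⟨ sumFin²-+ (λ i j → c i j * F i x * G j y) (λ i j → c i j * G i x * F j y) ⟩
      sumFin² (λ i j → c i j * F i x * G j y) + sumFin² (λ i j → c i j * G i x * F j y)
        ≡⟨ cong₂ _+_ (trans (sumFin²-cong (λ i j → pullˡ (c i j) (Ψᵉ e x) _ _))
                            (sumFin²-scale (Ψᵉ e x) (λ i j → c i j * (+ 2 * x + + 1) ^ toℕ i * (+ 2 * y) ^ toℕ j)))
                     (trans (sumFin²-cong (λ i j → pullʳ (c i j) (Ψᵉ e y) _ _))
                            (sumFin²-scale (Ψᵉ e y) (λ i j → c i j * (+ 2 * x) ^ toℕ i * (+ 2 * y + + 1) ^ toℕ j))) ⟩
      Ψᵉ e x * eval P (+ 2 * x + + 1) (+ 2 * y) + Ψᵉ e y * eval P (+ 2 * x) (+ 2 * y + + 1)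
        ∎
      where
      open ≡-Reasoning
      double : ∀ K a b c d → + 2 * ((K * + 1 * + 1 + + 0) + + 0 + (a + b) + (c + d)) ≡ (K + K) + + 2 * (a + b) + + 2 * (c + d)
      double = solve-∀
      pullˡ : ∀ c p u v → c * (p * u) * v ≡ p * (c * u * v)
      pullˡ = solve-∀
      pullʳ : ∀ c p u v → c * u * (p * v) ≡ p * (c * u * v)
      pullʳ = solve-∀

  digitColumn-Z : ∀ x y → digitColumn e Z P x y ≡ + 1 * eval QZ (+ x) (+ y)
  digitColumn-Z x y = trans (cong₂ (λ u v → eval P u v * + 1 * + 1 + + 0 + + 0) (+[2x] x) (+[2x] y))
    (trans (unit _) (cong (+ 1 *_) (sym (eval-QZ (+ x) (+ y)))))
    where
    unit : ∀ r → r * + 1 * + 1 + + 0 + + 0 ≡ + 1 * r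
    unit = solve-∀

  digitColumn-O : ∀ x y → digitColumn e O P x y ≡ + 1 * eval QO (+ x) (+ y)
  digitColumn-O x y =
    trans (cong₂ (λ u v → + 0 + (+ 0 + eval P u v * (Ψᵉ e (+ x) * + 1) * (Ψᵉ e (+ y) * + 1))) (+[1+2x] x) (+[1+2x] y))
      (trans (regroup _ (Ψᵉ e (+ x)) (Ψᵉ e (+ y))) (cong (+ 1 *_) (sym (eval-QO (+ x) (+ y)))))
    where
    regroup : ∀ r u v → + 0 + (+ 0 + r * (u * + 1) * (v * + 1)) ≡ + 1 * (u * v * r)
    regroup = solve-∀

  digitColumn-M : ∀ x y → digitColumn e M P x y ≡ + 2 * eval QM (+ x) (+ y)
  digitColumn-M x y = trans
    (cong₂ _+_ (cong₂ (λ u v → + 0 + eval P u v * + 1 * (Ψᵉ e (+ y) * + 1)) (+[2x] x) (+[1+2x] y))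
               (cong₂ (λ u v → eval P u v * (Ψᵉ e (+ x) * + 1) * + 1 + + 0) (+[1+2x] x) (+[2x] y)))
    (trans (regroup _ _ (Ψᵉ e (+ x)) (Ψᵉ e (+ y))) (sym (eval-QM (+ x) (+ y))))
    where
    regroup : ∀ r s u v → + 0 + r * + 1 * (v * + 1) + (s * (u * + 1) * + 1 + + 0) ≡ u * s + v * r
    regroup = solve-∀

lemma2 : (P : Poly2) → SymmetricPoly P → (k : ℕ) → (e : Vec ℕ (suc k)) →
    (Σ Poly2 λ QZ → SymmetricPoly QZ
        × (∀ x y → eval QZ x y ≡ eval P (+ 2 * x) (+ 2 * y))
        × (∀ (T : Word) → 𝔖 e (T ++ [ Z ]) P ≡ 𝔖 (0 ∷ e) T QZ))
    × (Σ Poly2 λ QO → SymmetricPoly QO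
        × (∀ x y → eval QO x y
                   ≡ Ψᵉ e x * Ψᵉ e y * eval P (+ 2 * x + + 1) (+ 2 * y + + 1))
        × (∀ (T : Word) → 𝔖 e (T ++ [ O ]) P ≡ 𝔖 (0 ∷ e) T QO))
    × (Σ Poly2 λ QM → SymmetricPoly QM
        × (∀ x y → + 2 * eval QM x y
                   ≡ Ψᵉ e x * eval P (+ 2 * x + + 1) (+ 2 * y)
                     + Ψᵉ e y * eval P (+ 2 * x) (+ 2 * y + + 1))
        × (∀ (T : Word) → 𝔖 e (T ++ [ M ]) P ≡ + 2 * 𝔖 (0 ∷ e) T QM))
lemma2 (poly2 n c) c-sym k e =
    (QZ , QZ-symmetric , eval-QZ , λ T → trans (𝔖-snoc e T Z P QZ (+ 1) digitColumn-Z) (*-identityˡ _))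
  , (QO , QO-symmetric , eval-QO , λ T → trans (𝔖-snoc e T O P QO (+ 1) digitColumn-O) (*-identityˡ _))
  , (QM , QM-symmetric , eval-QM , λ T → 𝔖-snoc e T M P QM (+ 2) digitColumn-M)
  where open Construction n c c-sym e
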